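{- If $\Delta;\Gamma\vdash_{\lambda^{hs}} s:\tau$, then $s$ is strongly normalizing with respect to $\lambda^{hs}$ reduction.
   Context: The calculus $\lambda^{hs}$. Simple variables $a$ and audited variables $u$ are disjoint. Labels $\psi\in\{\mathsf{refl},\mathsf{trans},\beta,\beta_\Box,\mathsf{ti},\mathsf{lam},\mathsf{app},\mathsf{let},\mathsf{trpl}_{[]},\mathsf{trpl}_{::},\mathsf{d}\}$. Types $\tau,\sigma ::= P\mid\tau\supset\sigma\mid\Box\tau$; terms $s,t ::= a\mid u\mid\lambda a^\tau.s\mid s\,t\mid\,!s\mid\mathsf{let}(u^\tau:=s,t)\mid\mathsf{TI}(\theta)$, $\theta$ a finite map from labels to terms. Trails $q ::= \mathsf{refl}(s)\mid\mathsf{trans}(q,q')\mid\beta(a^\tau.s,t)\mid\beta_\Box(s,u^\tau.t)\mid\mathsf{ti}(q,\theta)\mid\mathsf{lam}(a^\tau.q)\mid\mathsf{app}(q,q')\mid\mathsf{let}(q,u^\tau.q')\mid\mathsf{trpl}(\zeta)$. $q\theta$: if the head label of $q$ ($\mathsf{trpl}_{[]}$/$\mathsf{trpl}_{::}$ for $\mathsf{trpl}(\zeta)$ with $\zeta$ empty/nonempty) is not in $\mathrm{dom}(\theta)$ then $\theta(\mathsf{d})$; else atomic constructors $\mathsf{refl},\beta,\beta_\Box,\mathsf{ti}$ give $\theta$ of their label, $\mathsf{trans}(q_1,q_2)\theta=\theta(\mathsf{trans})(q_1\theta)(q_2\theta)$ and likewise $\mathsf{app},\mathsf{let}$, $\mathsf{lam}(a^\tau.q_1)\theta=\theta(\mathsf{lam})(q_1\theta)$,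 $\mathsf{trpl}(\{\})\theta=\theta(\mathsf{trpl}_{[]})$, $\mathsf{trpl}(\{q_1/\psi_1,\vec{q'/\psi'}\})\theta=\theta(\mathsf{trpl}_{::})(q_1\theta)(\mathsf{trpl}(\{\vec{q'/\psi'}\})\theta)$. $s[t/a]$: capture-avoiding, not entering $!$; $s[t/u]$: capture-avoiding, entering $!$. $\mathcal T^\sigma(\psi)=\sigma$ for $\psi\in\{\mathsf{d},\mathsf{refl},\beta,\beta_\Box,\mathsf{ti},\mathsf{trpl}_{[]}\}$, $\sigma\supset\sigma$ for $\mathsf{lam}$, $\sigma\supset\sigma\supset\sigma$ for $\mathsf{trans},\mathsf{app},\mathsf{let},\mathsf{trpl}_{::}$. Typing $\Delta;\Gamma\vdash s:\tau$: $a:\tau$ if $a:\tau\in\Gamma$; $u:\tau$ if $u::\tau\in\Delta$; $\lambda a^\tau.s:\tau\supset\sigma$ if $\Delta;\Gamma,a:\tau\vdash s:\sigma$; $s\,t:\sigma$ if $s:\tau\supset\sigma$, $t:\tau$; $\Delta;\Gamma\vdash\,!s:\Box\tau$ if $\Delta;\cdot\vdash s:\tau$; $\mathsf{let}(u^\tau:=s,t):\sigma$ if $s:\Box\tau$ and $\Delta,u::\tau;\Gamma\vdash t:\sigma$; $\Delta;\Gamma\vdash\mathsf{TI}(\theta):\sigma$ if $\mathsf{d}\in\mathrm{dom}(\theta)$ and $\Delta;\cdot\vdash\theta(\psi):\mathcal T^\sigma(\psi)$ for all $\psi\in\mathrm{dom}(\theta)$. Reduction: the closure under all contexts (including under $\lambda$,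 $!$, inside both arguments of $\mathsf{let}$ and any branch of $\mathsf{TI}$) of $(\lambda a^\tau.s)\,t\to s[t/a]$, $\mathsf{let}(u^\tau:=\,!s,t)\to t[s/u]$, and $\mathsf{TI}(\theta)\to q\theta$ for any trail $q$. -}

module Defs where

open import Data.Nat using (ℕ; zero; suc)
open import Data.List using (List; []; _∷_)
open import Data.Maybe using (Maybe; just; nothing; _<∣>_)
open import Data.Product using (Σ; _×_; _,_)
open import Relation.Binary.PropositionalEquality using (_≡_; _≢_)
open import Induction.WellFounded using (Acc)

data Label : Set where
  lRefl lTrans lBeta lBetaBox lTi lLam lApp lLet lTrplNil lTrplCons lD : Label

allLabels : List Label
allLabels = lRefl ∷ lTrans ∷ lBeta ∷ lBetaBox ∷ lTi ∷ lLam ∷ lApp ∷ lLet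
          ∷ lTrplNil ∷ lTrplCons ∷ lD ∷ []

infixr 7 _⊃_
data Ty : Set where
  P   : ℕ → Ty
  _⊃_ : Ty → Ty → Ty
  □   : Ty → Ty

-- Terms, de Bruijn style with two disjoint index spaces:
-- `var n` is a simple variable (bound by lam), `avar n` an audited
-- variable (bound by the second argument of let).
-- A finite map θ from labels to terms is a function Label → Maybe Tm
-- (Label is finite); dom θ = labels sent to `just`.

data Tm : Set where
  var  : ℕ → Tm
  avar : ℕ → Tm
  lam  : Ty → Tm → Tm
  app  : Tm → Tm → Tm
  !_   : Tm → Tm
  lett : Ty → Tm → Tm → Tm         -- let(u^τ := s, t) (binds audited var 0 in t)
  TI   : (Label → Maybe Tm) → Tm

LMap : Set
LMap = Label → Maybe Tm

-- Trails.  ζ in trpl(ζ) is a finite map from labels to trails, its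
-- entries enumerated in the fixed order `allLabels`.

data Trail : Set where
  refl    : Tm → Trail
  trans   : Trail → Trail → Trail
  β       : Ty → Tm → Tm → Trail          -- β(a^τ.s, t)
  β□      : Tm → Ty → Tm → Trail          -- β□(s, u^τ.t)
  ti      : Trail → LMap → Trail
  lamT    : Ty → Trail → Trail
  appT    : Trail → Trail → Trail
  letT    : Trail → Ty → Trail → Trail    -- let(q, u^τ.q')
  trpl    : (Label → Maybe Trail) → Trail

-- Trail evaluation  q θ  (partial: undefined only if needed entries of θ,
-- in particular θ(d), are missing)

private
  ap2 : Tm → Maybe Tm → Maybe Tm → Maybe Tm
  ap2 f (just x) (just y) = just (app (app f x) y)
  ap2 f _ _ = nothing

  ap1 : Tm → Maybe Tm → Maybe Tm
  ap1 f (just x) = just (app f x)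
  ap1 f nothing = nothing

  atom : Label → LMap → Maybe Tm
  atom ψ θ = θ ψ <∣> θ lD

  bin : Label → LMap → Maybe Tm → Maybe Tm → Maybe Tm
  bin ψ θ x y with θ ψ
  ... | nothing = θ lD
  ... | just f  = ap2 f x y

  un : Label → LMap → Maybe Tm → Maybe Tm
  un ψ θ x with θ ψ
  ... | nothing = θ lD
  ... | just f  = ap1 f x

mutual
  evalT : Trail → LMap → Maybe Tm
  evalT (refl _)       θ = atom lRefl θ
  evalT (β _ _ _)      θ = atom lBeta θ
  evalT (β□ _ _ _)     θ = atom lBetaBox θ
  evalT (ti _ _)       θ = atom lTi θ
  evalT (trans q₁ q₂)  θ = bin lTrans θ (evalT q₁ θ) (evalT q₂ θ)
  evalT (appT q₁ q₂)   θ = bin lApp θ (evalT q₁ θ) (evalT q₂ θ)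
  evalT (letT q₁ _ q₂) θ = bin lLet θ (evalT q₁ θ) (evalT q₂ θ)
  evalT (lamT _ q₁)    θ = un lLam θ (evalT q₁ θ)
  evalT (trpl ζ)       θ = evalZ ζ allLabels θ

  -- evaluation of trpl(ζ restricted to the labels in the list)
  evalZ : (Label → Maybe Trail) → List Label → LMap → Maybe Tm
  evalZ ζ []       θ = atom lTrplNil θ
  evalZ ζ (l ∷ ls) θ = evalZ' ζ ls θ (ζ l)

  evalZ' : (Label → Maybe Trail) → List Label → LMap → Maybe Trail → Maybe Tm
  evalZ' ζ ls θ nothing  = evalZ ζ ls θ
  evalZ' ζ ls θ (just q) = bin lTrplCons θ (evalT q θ) (evalZ ζ ls θ)

ext : (ℕ → ℕ) → ℕ → ℕ
ext ρ zero    = zero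
ext ρ (suc n) = suc (ρ n)

mutual
  renS : (ℕ → ℕ) → Tm → Tm
  renS ρ (var n)      = var (ρ n)
  renS ρ (avar n)     = avar n
  renS ρ (lam τ s)    = lam τ (renS (ext ρ) s)
  renS ρ (app s t)    = app (renS ρ s) (renS ρ t)
  renS ρ (! s)        = ! renS ρ s
  renS ρ (lett τ s t) = lett τ (renS ρ s) (renS ρ t)
  renS ρ (TI θ)       = TI (λ ψ → renSM ρ (θ ψ))

  renSM : (ℕ → ℕ) → Maybe Tm → Maybe Tm
  renSM ρ nothing  = nothing
  renSM ρ (just s) = just (renS ρ s)

mutual
  renA : (ℕ → ℕ) → Tm → Tm
  renA ρ (var n)      = var n
  renA ρ (avar n)     = avar (ρ n)
  renA ρ (lam τ s)    = lam τ (renA ρ s)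
  renA ρ (app s t)    = app (renA ρ s) (renA ρ t)
  renA ρ (! s)        = ! renA ρ s
  renA ρ (lett τ s t) = lett τ (renA ρ s) (renA (ext ρ) t)
  renA ρ (TI θ)       = TI (λ ψ → renAM ρ (θ ψ))

  renAM : (ℕ → ℕ) → Maybe Tm → Maybe Tm
  renAM ρ nothing  = nothing
  renAM ρ (just s) = just (renA ρ s)

extsS : (ℕ → Tm) → ℕ → Tm
extsS σ zero    = var zero
extsS σ (suc n) = renS suc (σ n)

extsA : (ℕ → Tm) → ℕ → Tm
extsA σ zero    = avar zero
extsA σ (suc n) = renA suc (σ n)

mutual
  -- substitution for simple variables: capture-avoiding, NOT entering !
  substS : (ℕ → Tm) → Tm → Tm
  substS σ (var n)      = σ n
  substS σ (avar n)     = avar n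
  substS σ (lam τ s)    = lam τ (substS (extsS σ) s)
  substS σ (app s t)    = app (substS σ s) (substS σ t)
  substS σ (! s)        = ! s
  substS σ (lett τ s t) = lett τ (substS σ s) (substS (λ n → renA suc (σ n)) t)
  substS σ (TI θ)       = TI (λ ψ → substSM σ (θ ψ))

  substSM : (ℕ → Tm) → Maybe Tm → Maybe Tm
  substSM σ nothing  = nothing
  substSM σ (just s) = just (substS σ s)

mutual
  -- substitution for audited variables: capture-avoiding, entering !
  substA : (ℕ → Tm) → Tm → Tm
  substA σ (var n)      = var n
  substA σ (avar n)     = σ n
  substA σ (lam τ s)    = lam τ (substA (λ n → renS suc (σ n)) s)
  substA σ (app s t)    = app (substA σ s) (substA σ t)
  substA σ (! s)        = ! substA σ s
  substA σ (lett τ s t) = lett τ (substA σ s) (substA (extsA σ) t)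
  substA σ (TI θ)       = TI (λ ψ → substAM σ (θ ψ))

  substAM : (ℕ → Tm) → Maybe Tm → Maybe Tm
  substAM σ nothing  = nothing
  substAM σ (just s) = just (substA σ s)

_[_/a] : Tm → Tm → Tm
s [ t /a] = substS σ s
  where σ : ℕ → Tm
        σ zero    = t
        σ (suc n) = var n

_[_/u] : Tm → Tm → Tm
s [ t /u] = substA σ s
  where σ : ℕ → Tm
        σ zero    = t
        σ (suc n) = avar n

Ctx : Set
Ctx = List Ty

data _∋_∶_ : Ctx → ℕ → Ty → Set where
  here  : ∀ {Γ τ} → (τ ∷ Γ) ∋ zero ∶ τ
  there : ∀ {Γ τ σ n} → Γ ∋ n ∶ τ → (σ ∷ Γ) ∋ suc n ∶ τ

𝒯 : Ty → Label → Ty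
𝒯 σ lLam      = σ ⊃ σ
𝒯 σ lTrans    = σ ⊃ σ ⊃ σ
𝒯 σ lApp      = σ ⊃ σ ⊃ σ
𝒯 σ lLet      = σ ⊃ σ ⊃ σ
𝒯 σ lTrplCons = σ ⊃ σ ⊃ σ
𝒯 σ lD        = σ
𝒯 σ lRefl     = σ
𝒯 σ lBeta     = σ
𝒯 σ lBetaBox  = σ
𝒯 σ lTi       = σ
𝒯 σ lTrplNil  = σ

data _︔_⊢_∶_ : Ctx → Ctx → Tm → Ty → Set where
  ⊢var  : ∀ {Δ Γ n τ} → Γ ∋ n ∶ τ → Δ ︔ Γ ⊢ var n ∶ τ
  ⊢avar : ∀ {Δ Γ n τ} → Δ ∋ n ∶ τ → Δ ︔ Γ ⊢ avar n ∶ τ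
  ⊢lam  : ∀ {Δ Γ s τ σ} → Δ ︔ (τ ∷ Γ) ⊢ s ∶ σ → Δ ︔ Γ ⊢ lam τ s ∶ (τ ⊃ σ)
  ⊢app  : ∀ {Δ Γ s t τ σ} → Δ ︔ Γ ⊢ s ∶ (τ ⊃ σ) → Δ ︔ Γ ⊢ t ∶ τ → Δ ︔ Γ ⊢ app s t ∶ σ
  ⊢box  : ∀ {Δ Γ s τ} → Δ ︔ [] ⊢ s ∶ τ → Δ ︔ Γ ⊢ (! s) ∶ □ τ
  ⊢let  : ∀ {Δ Γ s t τ σ} → Δ ︔ Γ ⊢ s ∶ □ τ → (τ ∷ Δ) ︔ Γ ⊢ t ∶ σ
        → Δ ︔ Γ ⊢ lett τ s t ∶ σ
  ⊢TI   : ∀ {Δ Γ θ σ} → Σ Tm (λ r → θ lD ≡ just r)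
        → (∀ ψ r → θ ψ ≡ just r → Δ ︔ [] ⊢ r ∶ 𝒯 σ ψ)
        → Δ ︔ Γ ⊢ TI θ ∶ σ

infix 4 _⟶_
data _⟶_ : Tm → Tm → Set where
  βstep  : ∀ {τ s t} → app (lam τ s) t ⟶ s [ t /a]
  β□step : ∀ {τ s t} → lett τ (! s) t ⟶ t [ s /u]
  TIstep : ∀ {θ r} (q : Trail) → evalT q θ ≡ just r → TI θ ⟶ r
  ξlam   : ∀ {τ s s'} → s ⟶ s' → lam τ s ⟶ lam τ s'
  ξappₗ  : ∀ {s s' t} → s ⟶ s' → app s t ⟶ app s' t
  ξappᵣ  : ∀ {s t t'} → t ⟶ t' → app s t ⟶ app s t'
  ξbox   : ∀ {s s'} → s ⟶ s' → (! s) ⟶ (! s')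
  ξletₗ  : ∀ {τ s s' t} → s ⟶ s' → lett τ s t ⟶ lett τ s' t
  ξletᵣ  : ∀ {τ s t t'} → t ⟶ t' → lett τ s t ⟶ lett τ s t'
  ξTI    : ∀ {θ θ' s s'} (ψ : Label) → θ ψ ≡ just s → s ⟶ s' → θ' ψ ≡ just s'
         → (∀ ψ' → ψ' ≢ ψ → θ' ψ' ≡ θ ψ')
         → TI θ ⟶ TI θ'

SN : Tm → Set
SN = Acc (λ t s → s ⟶ t)

-- Tait–Girard reducibility.  A type is interpreted as a set of strongly
-- normalising terms (at □ τ: those whose reducts of the form ! r have r
-- reducible at τ), and a typed term under reducible substitutions for
-- its simple and audited variables is reducible.  The new case is
-- TI(θ): its branch θ(ψ) is reducible at 𝒯^σ(ψ), so every trail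
-- evaluation q θ, an applicative combination of branches, is reducible
-- at σ; and reductions inside the branches terminate lexicographically.

module Submission where

open import Defs
open import Data.Nat using (ℕ; zero; suc; _<_; _≤_; z≤n; s≤s; _⊔_)
open import Data.Nat.Properties using (≤-trans; ≤-refl; m≤m⊔n; m≤n⊔m; m<1+n⇒m<n∨m≡n)
  renaming (_≟_ to _≟ℕ_)
open import Data.List using (List; []; _∷_; length)
open import Data.List.Membership.Propositional using (_∈_)
open import Data.List.Relation.Unary.Any using (here; there)
open import Data.Maybe using (Maybe; just; nothing; _<∣>_)
open import Data.Maybe.Properties using (just-injective)
open import Data.Maybe.Relation.Binary.Pointwise using (Pointwise; just; nothing; just-inv)
open import Data.Product using (∃-syntax; _×_; _,_; proj₁; proj₂)
open import Data.Empty using (⊥-elim)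
open import Data.Unit using (⊤; tt)
open import Data.Sum using (_⊎_; inj₁; inj₂)
open import Function using (_∘_; flip; case_of_)
open import Relation.Binary.Bundles using (Setoid)
import Relation.Binary.Reasoning.Setoid
open import Relation.Binary.PropositionalEquality
  using (_≡_; _≢_; _≗_; refl; sym; cong; subst)
  renaming (trans to ≡-trans)
open import Relation.Nullary using (Dec; yes; no)
open import Relation.Nullary.Decidable using (map′)
open import Induction.WellFounded using (Acc; acc)
open import Relation.Binary.Construct.Closure.ReflexiveTransitive using (Star; ε; _◅_)

labelIndex : Label → ℕ
labelIndex lRefl     = 0
labelIndex lTrans    = 1
labelIndex lBeta     = 2
labelIndex lBetaBox  = 3
labelIndex lTi       = 4
labelIndex lLam      = 5
labelIndex lApp      = 6
labelIndex lLet      = 7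
labelIndex lTrplNil  = 8
labelIndex lTrplCons = 9
labelIndex lD        = 10

indexLabel : ℕ → Label
indexLabel 0 = lRefl
indexLabel 1 = lTrans
indexLabel 2 = lBeta
indexLabel 3 = lBetaBox
indexLabel 4 = lTi
indexLabel 5 = lLam
indexLabel 6 = lApp
indexLabel 7 = lLet
indexLabel 8 = lTrplNil
indexLabel 9 = lTrplCons
indexLabel _ = lD

indexLabel-labelIndex : ∀ ψ → indexLabel (labelIndex ψ) ≡ ψ
indexLabel-labelIndex lRefl     = refl
indexLabel-labelIndex lTrans    = refl
indexLabel-labelIndex lBeta     = refl
indexLabel-labelIndex lBetaBox  = refl
indexLabel-labelIndex lTi       = refl
indexLabel-labelIndex lLam      = refl
indexLabel-labelIndex lApp      = refl
indexLabel-labelIndex lLet      = refl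
indexLabel-labelIndex lTrplNil  = refl
indexLabel-labelIndex lTrplCons = refl
indexLabel-labelIndex lD        = refl

labelIndex-injective : ∀ {ψ ψ'} → labelIndex ψ ≡ labelIndex ψ' → ψ ≡ ψ'
labelIndex-injective {ψ} {ψ'} eq =
  ≡-trans (sym (indexLabel-labelIndex ψ)) (≡-trans (cong indexLabel eq) (indexLabel-labelIndex ψ'))

infix 4 _≟ᴸ_
_≟ᴸ_ : (ψ ψ' : Label) → Dec (ψ ≡ ψ')
ψ ≟ᴸ ψ' = map′ labelIndex-injective (cong labelIndex) (labelIndex ψ ≟ℕ labelIndex ψ')

∈-allLabels : ∀ ψ → ψ ∈ allLabels
∈-allLabels lRefl     = here refl
∈-allLabels lTrans    = there (here refl)
∈-allLabels lBeta     = there (there (here refl))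
∈-allLabels lBetaBox  = there (there (there (here refl)))
∈-allLabels lTi       = there (there (there (there (here refl))))
∈-allLabels lLam      = there (there (there (there (there (here refl)))))
∈-allLabels lApp      = there (there (there (there (there (there (here refl))))))
∈-allLabels lLet      = there (there (there (there (there (there (there (here refl)))))))
∈-allLabels lTrplNil  = there (there (there (there (there (there (there (there (here refl))))))))
∈-allLabels lTrplCons = there (there (there (there (there (there (there (there (there (here refl)))))))))
∈-allLabels lD        = there (there (there (there (there (there (there (there (there (there (here refl))))))))))

-- Label maps are functions, so without function extensionality the
-- substitution laws only hold up to ≈, which reduction respects.

infix 4 _≈_ _≈ᴹ_ _≈ˢ_

data _≈_ : Tm → Tm → Set where
  var  : ∀ {n} → var n ≈ var n
  avar : ∀ {n} → avar n ≈ avar n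
  lam  : ∀ {τ s s'} → s ≈ s' → lam τ s ≈ lam τ s'
  app  : ∀ {s s' t t'} → s ≈ s' → t ≈ t' → app s t ≈ app s' t'
  box  : ∀ {s s'} → s ≈ s' → (! s) ≈ (! s')
  lett : ∀ {τ s s' t t'} → s ≈ s' → t ≈ t' → lett τ s t ≈ lett τ s' t'
  TI   : ∀ {θ θ'} → (∀ ψ → Pointwise _≈_ (θ ψ) (θ' ψ)) → TI θ ≈ TI θ'

_≈ᴹ_ : Maybe Tm → Maybe Tm → Set
_≈ᴹ_ = Pointwise _≈_

_≈ˢ_ : (ℕ → Tm) → (ℕ → Tm) → Set
σ ≈ˢ σ' = ∀ n → σ n ≈ σ' n

mutual
  ≈-refl : ∀ {s} → s ≈ s
  ≈-refl {var n}      = var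
  ≈-refl {avar n}     = avar
  ≈-refl {lam τ s}    = lam ≈-refl
  ≈-refl {app s t}    = app ≈-refl ≈-refl
  ≈-refl {(! s)}      = box ≈-refl
  ≈-refl {lett τ s t} = lett ≈-refl ≈-refl
  ≈-refl {TI θ}       = TI (λ ψ → ≈ᴹ-refl (θ ψ))

  ≈ᴹ-refl : ∀ m → m ≈ᴹ m
  ≈ᴹ-refl nothing  = nothing
  ≈ᴹ-refl (just s) = just ≈-refl

mutual
  ≈-sym : ∀ {s s'} → s ≈ s' → s' ≈ s
  ≈-sym var        = var
  ≈-sym avar       = avar
  ≈-sym (lam e)    = lam (≈-sym e)
  ≈-sym (app e f)  = app (≈-sym e) (≈-sym f)
  ≈-sym (box e)    = box (≈-sym e)
  ≈-sym (lett e f) = lett (≈-sym e) (≈-sym f)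
  ≈-sym (TI h)     = TI (λ ψ → ≈ᴹ-sym (h ψ))

  ≈ᴹ-sym : ∀ {m m'} → m ≈ᴹ m' → m' ≈ᴹ m
  ≈ᴹ-sym nothing  = nothing
  ≈ᴹ-sym (just e) = just (≈-sym e)

mutual
  ≈-trans : ∀ {s s' s''} → s ≈ s' → s' ≈ s'' → s ≈ s''
  ≈-trans var          var          = var
  ≈-trans avar         avar         = avar
  ≈-trans (lam e)      (lam f)      = lam (≈-trans e f)
  ≈-trans (app e e')   (app f f')   = app (≈-trans e f) (≈-trans e' f')
  ≈-trans (box e)      (box f)      = box (≈-trans e f)
  ≈-trans (lett e e')  (lett f f')  = lett (≈-trans e f) (≈-trans e' f')
  ≈-trans (TI h)       (TI k)       = TI (λ ψ → ≈ᴹ-trans (h ψ) (k ψ))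

  ≈ᴹ-trans : ∀ {m m' m''} → m ≈ᴹ m' → m' ≈ᴹ m'' → m ≈ᴹ m''
  ≈ᴹ-trans nothing  nothing  = nothing
  ≈ᴹ-trans (just e) (just f) = just (≈-trans e f)

≈-setoid : Setoid _ _
≈-setoid = record
  { Carrier       = Tm
  ; _≈_           = _≈_
  ; isEquivalence = record { refl = ≈-refl ; sym = ≈-sym ; trans = ≈-trans }
  }

module ≈-Reasoning = Relation.Binary.Reasoning.Setoid ≈-setoid

infixr 5 _⟨≈⟩_
_⟨≈⟩_ : ∀ {s s' s''} → s ≈ s' → s' ≈ s'' → s ≈ s''
_⟨≈⟩_ = ≈-trans

ext-cong : ∀ {ρ ρ'} → ρ ≗ ρ' → ext ρ ≗ ext ρ'
ext-cong h zero    = refl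
ext-cong h (suc n) = cong suc (h n)

mutual
  renS-cong : ∀ {ρ ρ' s s'} → ρ ≗ ρ' → s ≈ s' → renS ρ s ≈ renS ρ' s'
  renS-cong h (var {n}) rewrite h n = var
  renS-cong h avar       = avar
  renS-cong h (lam e)    = lam (renS-cong (ext-cong h) e)
  renS-cong h (app e f)  = app (renS-cong h e) (renS-cong h f)
  renS-cong h (box e)    = box (renS-cong h e)
  renS-cong h (lett e f) = lett (renS-cong h e) (renS-cong h f)
  renS-cong h (TI k)     = TI (λ ψ → renSM-cong h (k ψ))

  renSM-cong : ∀ {ρ ρ' m m'} → ρ ≗ ρ' → m ≈ᴹ m' → renSM ρ m ≈ᴹ renSM ρ' m'
  renSM-cong h nothing  = nothing
  renSM-cong h (just e) = just (renS-cong h e)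

mutual
  renA-cong : ∀ {ρ ρ' s s'} → ρ ≗ ρ' → s ≈ s' → renA ρ s ≈ renA ρ' s'
  renA-cong h var = var
  renA-cong h (avar {n}) rewrite h n = avar
  renA-cong h (lam e)    = lam (renA-cong h e)
  renA-cong h (app e f)  = app (renA-cong h e) (renA-cong h f)
  renA-cong h (box e)    = box (renA-cong h e)
  renA-cong h (lett e f) = lett (renA-cong h e) (renA-cong (ext-cong h) f)
  renA-cong h (TI k)     = TI (λ ψ → renAM-cong h (k ψ))

  renAM-cong : ∀ {ρ ρ' m m'} → ρ ≗ ρ' → m ≈ᴹ m' → renAM ρ m ≈ᴹ renAM ρ' m'
  renAM-cong h nothing  = nothing
  renAM-cong h (just e) = just (renA-cong h e)

renS-resp-≈ : ∀ {ρ s s'} → s ≈ s' → renS ρ s ≈ renS ρ s'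
renS-resp-≈ = renS-cong (λ _ → refl)

renA-resp-≈ : ∀ {ρ s s'} → s ≈ s' → renA ρ s ≈ renA ρ s'
renA-resp-≈ = renA-cong (λ _ → refl)

mutual
  substS-cong : ∀ {σ σ' s s'} → σ ≈ˢ σ' → s ≈ s' → substS σ s ≈ substS σ' s'
  substS-cong h (var {n})  = h n
  substS-cong h avar       = avar
  substS-cong h (lam e)    = lam (substS-cong extsS-h e)
    where extsS-h : extsS _ ≈ˢ extsS _
          extsS-h zero    = var
          extsS-h (suc n) = renS-resp-≈ (h n)
  substS-cong h (app e f)  = app (substS-cong h e) (substS-cong h f)
  substS-cong h (box e)    = box e
  substS-cong h (lett e f) = lett (substS-cong h e) (substS-cong (renA-resp-≈ ∘ h) f)
  substS-cong h (TI k)     = TI (λ ψ → substSM-cong h (k ψ))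

  substSM-cong : ∀ {σ σ' m m'} → σ ≈ˢ σ' → m ≈ᴹ m' → substSM σ m ≈ᴹ substSM σ' m'
  substSM-cong h nothing  = nothing
  substSM-cong h (just e) = just (substS-cong h e)

mutual
  substA-cong : ∀ {σ σ' s s'} → σ ≈ˢ σ' → s ≈ s' → substA σ s ≈ substA σ' s'
  substA-cong h var          = var
  substA-cong h (avar {n})   = h n
  substA-cong h (lam e)      = lam (substA-cong (renS-resp-≈ ∘ h) e)
  substA-cong h (app e f)    = app (substA-cong h e) (substA-cong h f)
  substA-cong h (box e)      = box (substA-cong h e)
  substA-cong h (lett e f)   = lett (substA-cong h e) (substA-cong extsA-h f)
    where extsA-h : extsA _ ≈ˢ extsA _
          extsA-h zero    = avar
          extsA-h (suc n) = renA-resp-≈ (h n)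
  substA-cong h (TI k)       = TI (λ ψ → substAM-cong h (k ψ))

  substAM-cong : ∀ {σ σ' m m'} → σ ≈ˢ σ' → m ≈ᴹ m' → substAM σ m ≈ᴹ substAM σ' m'
  substAM-cong h nothing  = nothing
  substAM-cong h (just e) = just (substA-cong h e)

substS-resp-≈ : ∀ {σ s s'} → s ≈ s' → substS σ s ≈ substS σ s'
substS-resp-≈ = substS-cong (λ _ → ≈-refl)

substA-resp-≈ : ∀ {σ s s'} → s ≈ s' → substA σ s ≈ substA σ s'
substA-resp-≈ = substA-cong (λ _ → ≈-refl)

substS-resp-≈ˢ : ∀ {σ σ'} → σ ≈ˢ σ' → ∀ s → substS σ s ≈ substS σ' s
substS-resp-≈ˢ h s = substS-cong h (≈-refl {s})

substA-resp-≈ˢ : ∀ {σ σ'} → σ ≈ˢ σ' → ∀ s → substA σ s ≈ substA σ' s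
substA-resp-≈ˢ h s = substA-cong h (≈-refl {s})

-- Simple substitution does not enter !, so it is only well behaved on
-- terms whose boxed subterms have no free simple variables.
data Scoped : ℕ → Tm → Set where
  var  : ∀ {k n} → n < k → Scoped k (var n)
  avar : ∀ {k n} → Scoped k (avar n)
  lam  : ∀ {k τ s} → Scoped (suc k) s → Scoped k (lam τ s)
  app  : ∀ {k s t} → Scoped k s → Scoped k t → Scoped k (app s t)
  box  : ∀ {k s} → Scoped 0 s → Scoped k (! s)
  lett : ∀ {k τ s t} → Scoped k s → Scoped k t → Scoped k (lett τ s t)
  TI   : ∀ {k θ} → (∀ ψ r → θ ψ ≡ just r → Scoped k r) → Scoped k (TI θ)

Scopedᴹ : ℕ → Maybe Tm → Set
Scopedᴹ k m = ∀ r → m ≡ just r → Scoped k r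

WellScoped : Tm → Set
WellScoped t = ∃[ k ] Scoped k t

WellScopedSubst : (ℕ → Tm) → Set
WellScopedSubst σ = ∀ n → WellScoped (σ n)

ScopedSubst : ℕ → ℕ → (ℕ → Tm) → Set
ScopedSubst k k' σ = ∀ n → n < k → Scoped k' (σ n)

ClosedSubst : (ℕ → Tm) → Set
ClosedSubst σ = ∀ n → Scoped 0 (σ n)

mutual
  Scoped-weaken : ∀ {k k' s} → k ≤ k' → Scoped k s → Scoped k' s
  Scoped-weaken le (var n<k)   = var (≤-trans n<k le)
  Scoped-weaken le avar        = avar
  Scoped-weaken le (lam d)     = lam (Scoped-weaken (s≤s le) d)
  Scoped-weaken le (app d e)   = app (Scoped-weaken le d) (Scoped-weaken le e)
  Scoped-weaken le (box d)     = box d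
  Scoped-weaken le (lett d e)  = lett (Scoped-weaken le d) (Scoped-weaken le e)
  Scoped-weaken le (TI d)      = TI (λ ψ → Scopedᴹ-weaken le (d ψ))

  Scopedᴹ-weaken : ∀ {k k' m} → k ≤ k' → Scopedᴹ k m → Scopedᴹ k' m
  Scopedᴹ-weaken {m = just r} le d .r refl = Scoped-weaken le (d r refl)

WellScoped-app : ∀ {f x} → WellScoped f → WellScoped x → WellScoped (app f x)
WellScoped-app (k , d) (j , e) = k ⊔ j , app (Scoped-weaken (m≤m⊔n k j) d) (Scoped-weaken (m≤n⊔m k j) e)

ext-< : ∀ {ρ k k'} → (∀ n → n < k → ρ n < k') → ∀ n → n < suc k → ext ρ n < suc k'
ext-< h zero    _        = s≤s z≤n
ext-< h (suc n) (s≤s lt) = s≤s (h n lt)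

mutual
  Scoped-renS : ∀ {k k' ρ s} → (∀ n → n < k → ρ n < k') → Scoped k s → Scoped k' (renS ρ s)
  Scoped-renS h (var n<k)  = var (h _ n<k)
  Scoped-renS h avar       = avar
  Scoped-renS h (lam d)    = lam (Scoped-renS (ext-< h) d)
  Scoped-renS h (app d e)  = app (Scoped-renS h d) (Scoped-renS h e)
  Scoped-renS h (box d)    = box (Scoped-renS (λ _ ()) d)
  Scoped-renS h (lett d e) = lett (Scoped-renS h d) (Scoped-renS h e)
  Scoped-renS h (TI d)     = TI (λ ψ → Scopedᴹ-renS h (d ψ))

  Scopedᴹ-renS : ∀ {k k' ρ m} → (∀ n → n < k → ρ n < k') → Scopedᴹ k m → Scopedᴹ k' (renSM ρ m)
  Scopedᴹ-renS {m = just r} h d .(renS _ r) refl = Scoped-renS h (d r refl)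

Scoped-renS-suc : ∀ {k s} → Scoped k s → Scoped (suc k) (renS suc s)
Scoped-renS-suc = Scoped-renS (λ _ → s≤s)

Scoped-renS-closed : ∀ {k ρ s} → Scoped 0 s → Scoped k (renS ρ s)
Scoped-renS-closed = Scoped-renS (λ _ ())

mutual
  Scoped-renA : ∀ {k ρ s} → Scoped k s → Scoped k (renA ρ s)
  Scoped-renA (var n<k)  = var n<k
  Scoped-renA avar       = avar
  Scoped-renA (lam d)    = lam (Scoped-renA d)
  Scoped-renA (app d e)  = app (Scoped-renA d) (Scoped-renA e)
  Scoped-renA (box d)    = box (Scoped-renA d)
  Scoped-renA (lett d e) = lett (Scoped-renA d) (Scoped-renA e)
  Scoped-renA (TI d)     = TI (λ ψ → Scopedᴹ-renA (d ψ))

  Scopedᴹ-renA : ∀ {k ρ m} → Scopedᴹ k m → Scopedᴹ k (renAM ρ m)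
  Scopedᴹ-renA {m = just r} d .(renA _ r) refl = Scoped-renA (d r refl)

mutual
  Scoped-substS : ∀ {k k' σ s} → ScopedSubst k k' σ → Scoped k s → Scoped k' (substS σ s)
  Scoped-substS h (var n<k)  = h _ n<k
  Scoped-substS h avar       = avar
  Scoped-substS h (lam d)    = lam (Scoped-substS (Scoped-extsS h) d)
  Scoped-substS h (app d e)  = app (Scoped-substS h d) (Scoped-substS h e)
  Scoped-substS h (box d)    = box d
  Scoped-substS h (lett d e) = lett (Scoped-substS h d) (Scoped-substS (λ n lt → Scoped-renA (h n lt)) e)
  Scoped-substS h (TI d)     = TI (λ ψ → Scopedᴹ-substS h (d ψ))

  Scopedᴹ-substS : ∀ {k k' σ m} → ScopedSubst k k' σ → Scopedᴹ k m → Scopedᴹ k' (substSM σ m)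
  Scopedᴹ-substS {m = just r} h d .(substS _ r) refl = Scoped-substS h (d r refl)

  Scoped-extsS : ∀ {k k' σ} → ScopedSubst k k' σ → ScopedSubst (suc k) (suc k') (extsS σ)
  Scoped-extsS h zero    _        = var (s≤s z≤n)
  Scoped-extsS h (suc n) (s≤s lt) = Scoped-renS-suc (h n lt)

ClosedSubst-renS : ∀ {σ ρ} → ClosedSubst σ → ClosedSubst (renS ρ ∘ σ)
ClosedSubst-renS c = Scoped-renS-closed ∘ c

ClosedSubst-extsA : ∀ {σ} → ClosedSubst σ → ClosedSubst (extsA σ)
ClosedSubst-extsA c zero    = avar
ClosedSubst-extsA c (suc n) = Scoped-renA (c n)

mutual
  Scoped-substA : ∀ {k σ s} → ClosedSubst σ → Scoped k s → Scoped k (substA σ s)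
  Scoped-substA c (var n<k)  = var n<k
  Scoped-substA c avar       = Scoped-weaken z≤n (c _)
  Scoped-substA c (lam d)    = lam (Scoped-substA (ClosedSubst-renS c) d)
  Scoped-substA c (app d e)  = app (Scoped-substA c d) (Scoped-substA c e)
  Scoped-substA c (box d)    = box (Scoped-substA c d)
  Scoped-substA c (lett d e) = lett (Scoped-substA c d) (Scoped-substA (ClosedSubst-extsA c) e)
  Scoped-substA c (TI d)     = TI (λ ψ → Scopedᴹ-substA c (d ψ))

  Scopedᴹ-substA : ∀ {k σ m} → ClosedSubst σ → Scopedᴹ k m → Scopedᴹ k (substAM σ m)
  Scopedᴹ-substA {m = just r} c d .(substA _ r) refl = Scoped-substA c (d r refl)

mutual
  renS-identity : ∀ {k ρ w} → (∀ n → n < k → ρ n ≡ n) → Scoped k w → renS ρ w ≈ w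
  renS-identity h (var {n = n} lt) rewrite h n lt = var
  renS-identity h avar       = avar
  renS-identity h (lam d)    = lam (renS-identity ext-h d)
    where ext-h : ∀ n → n < suc _ → ext _ n ≡ n
          ext-h zero    _        = refl
          ext-h (suc n) (s≤s lt) = cong suc (h n lt)
  renS-identity h (app d e)  = app (renS-identity h d) (renS-identity h e)
  renS-identity h (box d)    = box (renS-identity (λ _ ()) d)
  renS-identity h (lett d e) = lett (renS-identity h d) (renS-identity h e)
  renS-identity h (TI d)     = TI (λ ψ → renSM-identity h (d ψ))

  renSM-identity : ∀ {k ρ m} → (∀ n → n < k → ρ n ≡ n) → Scopedᴹ k m → renSM ρ m ≈ᴹ m
  renSM-identity {m = nothing} h d = nothing
  renSM-identity {m = just r}  h d = just (renS-identity h (d r refl))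

renS-closed : ∀ {ρ w} → Scoped 0 w → renS ρ w ≈ w
renS-closed = renS-identity (λ _ ())

mutual
  substS-identity : ∀ {k σ w} → (∀ n → n < k → σ n ≈ var n) → Scoped k w → substS σ w ≈ w
  substS-identity h (var lt)   = h _ lt
  substS-identity h avar       = avar
  substS-identity h (lam d)    = lam (substS-identity extsS-h d)
    where extsS-h : ∀ n → n < suc _ → extsS _ n ≈ var n
          extsS-h zero    _        = var
          extsS-h (suc n) (s≤s lt) = renS-resp-≈ (h n lt)
  substS-identity h (app d e)  = app (substS-identity h d) (substS-identity h e)
  substS-identity h (box d)    = ≈-refl
  substS-identity h (lett d e) = lett (substS-identity h d) (substS-identity (λ n lt → renA-resp-≈ (h n lt)) e)
  substS-identity h (TI d)     = TI (λ ψ → substSM-identity h (d ψ))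

  substSM-identity : ∀ {k σ m} → (∀ n → n < k → σ n ≈ var n) → Scopedᴹ k m → substSM σ m ≈ᴹ m
  substSM-identity {m = nothing} h d = nothing
  substSM-identity {m = just r}  h d = just (substS-identity h (d r refl))

substS-closed : ∀ {σ w} → Scoped 0 w → substS σ w ≈ w
substS-closed = substS-identity (λ _ ())

mutual
  substS-var : ∀ {σ} → σ ≈ˢ var → ∀ v → substS σ v ≈ v
  substS-var h (var n)      = h n
  substS-var h (avar n)     = avar
  substS-var h (lam _ v)    = lam (substS-var extsS-h v)
    where extsS-h : extsS _ ≈ˢ var
          extsS-h zero    = var
          extsS-h (suc n) = renS-resp-≈ (h n)
  substS-var h (app s t)    = app (substS-var h s) (substS-var h t)
  substS-var h (! s)        = ≈-refl
  substS-var h (lett _ s t) = lett (substS-var h s) (substS-var (renA-resp-≈ ∘ h) t)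
  substS-var h (TI θ)       = TI (λ ψ → substSM-var h (θ ψ))

  substSM-var : ∀ {σ} → σ ≈ˢ var → ∀ m → substSM σ m ≈ᴹ m
  substSM-var h nothing  = nothing
  substSM-var h (just s) = just (substS-var h s)

mutual
  substA-avar : ∀ {σ} → σ ≈ˢ avar → ∀ v → substA σ v ≈ v
  substA-avar h (var n)      = var
  substA-avar h (avar n)     = h n
  substA-avar h (lam _ v)    = lam (substA-avar (renS-resp-≈ ∘ h) v)
  substA-avar h (app s t)    = app (substA-avar h s) (substA-avar h t)
  substA-avar h (! s)        = box (substA-avar h s)
  substA-avar h (lett _ s t) = lett (substA-avar h s) (substA-avar extsA-h t)
    where extsA-h : extsA _ ≈ˢ avar
          extsA-h zero    = avar
          extsA-h (suc n) = renA-resp-≈ (h n)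
  substA-avar h (TI θ)       = TI (λ ψ → substAM-avar h (θ ψ))

  substAM-avar : ∀ {σ} → σ ≈ˢ avar → ∀ m → substAM σ m ≈ᴹ m
  substAM-avar h nothing  = nothing
  substAM-avar h (just s) = just (substA-avar h s)

ext-∘ : ∀ ρ ρ' → ext ρ ∘ ext ρ' ≗ ext (ρ ∘ ρ')
ext-∘ ρ ρ' zero    = refl
ext-∘ ρ ρ' (suc n) = refl

mutual
  renS-renS : ∀ {ρ ρ'} v → renS ρ (renS ρ' v) ≈ renS (ρ ∘ ρ') v
  renS-renS (var n)      = var
  renS-renS (avar n)     = avar
  renS-renS {ρ} {ρ'} (lam τ v) = lam (renS-renS v ⟨≈⟩ renS-cong (ext-∘ ρ ρ') ≈-refl)
  renS-renS (app s t)    = app (renS-renS s) (renS-renS t)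
  renS-renS (! s)        = box (renS-renS s)
  renS-renS (lett τ s t) = lett (renS-renS s) (renS-renS t)
  renS-renS (TI θ)       = TI (λ ψ → renSM-renSM (θ ψ))

  renSM-renSM : ∀ {ρ ρ'} m → renSM ρ (renSM ρ' m) ≈ᴹ renSM (ρ ∘ ρ') m
  renSM-renSM nothing  = nothing
  renSM-renSM (just s) = just (renS-renS s)

mutual
  renA-renA : ∀ {ρ ρ'} v → renA ρ (renA ρ' v) ≈ renA (ρ ∘ ρ') v
  renA-renA (var n)      = var
  renA-renA (avar n)     = avar
  renA-renA (lam τ v)    = lam (renA-renA v)
  renA-renA (app s t)    = app (renA-renA s) (renA-renA t)
  renA-renA (! s)        = box (renA-renA s)
  renA-renA {ρ} {ρ'} (lett τ s t) = lett (renA-renA s) (renA-renA t ⟨≈⟩ renA-cong (ext-∘ ρ ρ') ≈-refl)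
  renA-renA (TI θ)       = TI (λ ψ → renAM-renAM (θ ψ))

  renAM-renAM : ∀ {ρ ρ'} m → renAM ρ (renAM ρ' m) ≈ᴹ renAM (ρ ∘ ρ') m
  renAM-renAM nothing  = nothing
  renAM-renAM (just s) = just (renA-renA s)

mutual
  renS-renA : ∀ {ρ ρ'} v → renS ρ (renA ρ' v) ≈ renA ρ' (renS ρ v)
  renS-renA (var n)      = var
  renS-renA (avar n)     = avar
  renS-renA (lam τ v)    = lam (renS-renA v)
  renS-renA (app s t)    = app (renS-renA s) (renS-renA t)
  renS-renA (! s)        = box (renS-renA s)
  renS-renA (lett τ s t) = lett (renS-renA s) (renS-renA t)
  renS-renA (TI θ)       = TI (λ ψ → renSM-renAM (θ ψ))

  renSM-renAM : ∀ {ρ ρ'} m → renSM ρ (renAM ρ' m) ≈ᴹ renAM ρ' (renSM ρ m)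
  renSM-renAM nothing  = nothing
  renSM-renAM (just s) = just (renS-renA s)

renS-ext-suc : ∀ {ρ} x → renS (ext ρ) (renS suc x) ≈ renS suc (renS ρ x)
renS-ext-suc x = renS-renS x ⟨≈⟩ ≈-sym (renS-renS x)

renA-ext-suc : ∀ {ρ} x → renA (ext ρ) (renA suc x) ≈ renA suc (renA ρ x)
renA-ext-suc x = renA-renA x ⟨≈⟩ ≈-sym (renA-renA x)

mutual
  substA-renA : ∀ {σ ρ} v → substA σ (renA ρ v) ≈ substA (σ ∘ ρ) v
  substA-renA (var n)      = var
  substA-renA (avar n)     = ≈-refl
  substA-renA (lam τ v)    = lam (substA-renA v)
  substA-renA (app s t)    = app (substA-renA s) (substA-renA t)
  substA-renA (! s)        = box (substA-renA s)
  substA-renA {σ} {ρ} (lett _ s t) = lett (substA-renA s) (substA-renA t ⟨≈⟩ substA-resp-≈ˢ h t)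
    where h : extsA σ ∘ ext ρ ≈ˢ extsA (σ ∘ ρ)
          h zero    = avar
          h (suc n) = ≈-refl
  substA-renA (TI θ)       = TI (λ ψ → substAM-renAM (θ ψ))

  substAM-renAM : ∀ {σ ρ} m → substAM σ (renAM ρ m) ≈ᴹ substAM (σ ∘ ρ) m
  substAM-renAM nothing  = nothing
  substAM-renAM (just s) = just (substA-renA s)

mutual
  renA-substA : ∀ {σ ρ} v → renA ρ (substA σ v) ≈ substA (renA ρ ∘ σ) v
  renA-substA (var n)      = var
  renA-substA (avar n)     = ≈-refl
  renA-substA (lam τ v)    = lam (renA-substA v ⟨≈⟩ substA-resp-≈ˢ (λ _ → ≈-sym (renS-renA _)) v)
  renA-substA (app s t)    = app (renA-substA s) (renA-substA t)
  renA-substA (! s)        = box (renA-substA s)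
  renA-substA {σ} {ρ} (lett _ s t) = lett (renA-substA s) (renA-substA t ⟨≈⟩ substA-resp-≈ˢ h t)
    where h : renA (ext ρ) ∘ extsA σ ≈ˢ extsA (renA ρ ∘ σ)
          h zero    = avar
          h (suc n) = renA-ext-suc (σ n)
  renA-substA (TI θ)       = TI (λ ψ → renAM-substAM (θ ψ))

  renAM-substAM : ∀ {σ ρ} m → renAM ρ (substAM σ m) ≈ᴹ substAM (renA ρ ∘ σ) m
  renAM-substAM nothing  = nothing
  renAM-substAM (just s) = just (renA-substA s)

substA-extsA-renA-suc : ∀ {σ} x → substA (extsA σ) (renA suc x) ≈ renA suc (substA σ x)
substA-extsA-renA-suc x = substA-renA x ⟨≈⟩ ≈-sym (renA-substA x)

mutual
  renS-substA : ∀ {σ ρ} v → substA (renS ρ ∘ σ) (renS ρ v) ≈ renS ρ (substA σ v)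
  renS-substA (var n)      = var
  renS-substA (avar n)     = ≈-refl
  renS-substA {σ} {ρ} (lam _ v) =
    lam (substA-resp-≈ˢ (λ n → ≈-sym (renS-ext-suc (σ n))) (renS (ext ρ) v) ⟨≈⟩ renS-substA v)
  renS-substA (app s t)    = app (renS-substA s) (renS-substA t)
  renS-substA (! s)        = box (renS-substA s)
  renS-substA {σ} {ρ} (lett _ s t) = lett (renS-substA s) (substA-resp-≈ˢ h (renS ρ t) ⟨≈⟩ renS-substA t)
    where h : extsA (renS ρ ∘ σ) ≈ˢ renS ρ ∘ extsA σ
          h zero    = avar
          h (suc n) = ≈-sym (renS-renA (σ n))
  renS-substA (TI θ)       = TI (λ ψ → renSM-substAM (θ ψ))

  renSM-substAM : ∀ {σ ρ} m → substAM (renS ρ ∘ σ) (renSM ρ m) ≈ᴹ renSM ρ (substAM σ m)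
  renSM-substAM nothing  = nothing
  renSM-substAM (just s) = just (renS-substA s)

mutual
  substA-substA : ∀ {σ σ'} v → substA σ (substA σ' v) ≈ substA (substA σ ∘ σ') v
  substA-substA (var n)      = var
  substA-substA (avar n)     = ≈-refl
  substA-substA {σ} {σ'} (lam _ v) = lam (substA-substA v ⟨≈⟩ substA-resp-≈ˢ (renS-substA ∘ σ') v)
  substA-substA (app s t)    = app (substA-substA s) (substA-substA t)
  substA-substA (! s)        = box (substA-substA s)
  substA-substA {σ} {σ'} (lett _ s t) = lett (substA-substA s) (substA-substA t ⟨≈⟩ substA-resp-≈ˢ h t)
    where h : substA (extsA σ) ∘ extsA σ' ≈ˢ extsA (substA σ ∘ σ')
          h zero    = avar
          h (suc n) = substA-extsA-renA-suc (σ' n)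
  substA-substA (TI θ)       = TI (λ ψ → substAM-substAM (θ ψ))

  substAM-substAM : ∀ {σ σ'} m → substAM σ (substAM σ' m) ≈ᴹ substAM (substA σ ∘ σ') m
  substAM-substAM nothing  = nothing
  substAM-substAM (just s) = just (substA-substA s)

mutual
  substS-renS : ∀ {k σ ρ v} → Scoped k v → substS σ (renS ρ v) ≈ substS (σ ∘ ρ) v
  substS-renS (var _)    = ≈-refl
  substS-renS avar       = avar
  substS-renS {σ = σ} {ρ} (lam {s = v} d) = lam (substS-renS d ⟨≈⟩ substS-resp-≈ˢ h v)
    where h : extsS σ ∘ ext ρ ≈ˢ extsS (σ ∘ ρ)
          h zero    = var
          h (suc n) = ≈-refl
  substS-renS (app d e)  = app (substS-renS d) (substS-renS e)
  substS-renS (box d)    = box (renS-closed d)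
  substS-renS (lett d e) = lett (substS-renS d) (substS-renS e)
  substS-renS (TI d)     = TI (λ ψ → substSM-renSM (d ψ))

  substSM-renSM : ∀ {k σ ρ m} → Scopedᴹ k m → substSM σ (renSM ρ m) ≈ᴹ substSM (σ ∘ ρ) m
  substSM-renSM {m = nothing} d = nothing
  substSM-renSM {m = just r}  d = just (substS-renS (d r refl))

mutual
  renS-substS : ∀ {k σ ρ v} → Scoped k v → renS ρ (substS σ v) ≈ substS (renS ρ ∘ σ) v
  renS-substS (var _)    = ≈-refl
  renS-substS avar       = avar
  renS-substS {σ = σ} {ρ} (lam {s = v} d) = lam (renS-substS d ⟨≈⟩ substS-resp-≈ˢ h v)
    where h : renS (ext ρ) ∘ extsS σ ≈ˢ extsS (renS ρ ∘ σ)
          h zero    = var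
          h (suc n) = renS-ext-suc (σ n)
  renS-substS (app d e)  = app (renS-substS d) (renS-substS e)
  renS-substS (box d)    = box (renS-closed d)
  renS-substS (lett {t = t} d e) =
    lett (renS-substS d) (renS-substS e ⟨≈⟩ substS-resp-≈ˢ (λ _ → renS-renA _) t)
  renS-substS (TI d)     = TI (λ ψ → renSM-substSM (d ψ))

  renSM-substSM : ∀ {k σ ρ m} → Scopedᴹ k m → renSM ρ (substSM σ m) ≈ᴹ substSM (renS ρ ∘ σ) m
  renSM-substSM {m = nothing} d = nothing
  renSM-substSM {m = just r}  d = just (renS-substS (d r refl))

substS-extsS-renS-suc : ∀ {k σ x} → Scoped k x → substS (extsS σ) (renS suc x) ≈ renS suc (substS σ x)
substS-extsS-renS-suc d = substS-renS d ⟨≈⟩ ≈-sym (renS-substS d)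

mutual
  renA-substS : ∀ {σ ρ} x → substS (renA ρ ∘ σ) (renA ρ x) ≈ renA ρ (substS σ x)
  renA-substS (var n)      = ≈-refl
  renA-substS (avar n)     = avar
  renA-substS {σ} {ρ} (lam _ v) = lam (substS-resp-≈ˢ h (renA ρ v) ⟨≈⟩ renA-substS v)
    where h : extsS (renA ρ ∘ σ) ≈ˢ renA ρ ∘ extsS σ
          h zero    = var
          h (suc n) = renS-renA (σ n)
  renA-substS (app s t)    = app (renA-substS s) (renA-substS t)
  renA-substS (! s)        = ≈-refl
  renA-substS {σ} {ρ} (lett _ s t) =
    lett (renA-substS s)
         (substS-resp-≈ˢ (λ n → ≈-sym (renA-ext-suc (σ n))) (renA (ext ρ) t) ⟨≈⟩ renA-substS t)
  renA-substS (TI θ)       = TI (λ ψ → renAM-substSM (θ ψ))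

  renAM-substSM : ∀ {σ ρ} m → substSM (renA ρ ∘ σ) (renAM ρ m) ≈ᴹ renAM ρ (substSM σ m)
  renAM-substSM nothing  = nothing
  renAM-substSM (just s) = just (renA-substS s)

WellScopedSubst-extsS : ∀ {σ} → WellScopedSubst σ → WellScopedSubst (extsS σ)
WellScopedSubst-extsS h zero    = 1 , var (s≤s z≤n)
WellScopedSubst-extsS h (suc n) = suc (proj₁ (h n)) , Scoped-renS-suc (proj₂ (h n))

WellScopedSubst-renA : ∀ {σ ρ} → WellScopedSubst σ → WellScopedSubst (renA ρ ∘ σ)
WellScopedSubst-renA h n = proj₁ (h n) , Scoped-renA (proj₂ (h n))

-- The inner substitution must be well scoped: it is pushed under binders by renS, which enters !.
mutual
  substS-substS : ∀ {σ σ'} → WellScopedSubst σ' → ∀ v → substS σ (substS σ' v) ≈ substS (substS σ ∘ σ') v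
  substS-substS ws (var n)      = ≈-refl
  substS-substS ws (avar n)     = avar
  substS-substS {σ} {σ'} ws (lam _ v) =
    lam (substS-substS (WellScopedSubst-extsS ws) v ⟨≈⟩ substS-resp-≈ˢ h v)
    where h : substS (extsS σ) ∘ extsS σ' ≈ˢ extsS (substS σ ∘ σ')
          h zero    = var
          h (suc n) = substS-extsS-renS-suc (proj₂ (ws n))
  substS-substS ws (app s t)    = app (substS-substS ws s) (substS-substS ws t)
  substS-substS ws (! s)        = ≈-refl
  substS-substS {σ} {σ'} ws (lett _ s t) =
    lett (substS-substS ws s)
         (substS-substS (WellScopedSubst-renA ws) t ⟨≈⟩ substS-resp-≈ˢ (renA-substS ∘ σ') t)
  substS-substS ws (TI θ)       = TI (λ ψ → substSM-substSM ws (θ ψ))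

  substSM-substSM : ∀ {σ σ'} → WellScopedSubst σ' → ∀ m
                  → substSM σ (substSM σ' m) ≈ᴹ substSM (substS σ ∘ σ') m
  substSM-substSM ws nothing  = nothing
  substSM-substSM ws (just s) = just (substS-substS ws s)

mutual
  substA-substS : ∀ {σA σ σ'} → ClosedSubst σA → substA σA ∘ σ' ≈ˢ σ → ∀ v
                → substA σA (substS σ' v) ≈ substS σ (substA σA v)
  substA-substS c h (var n)      = h n
  substA-substS c h (avar n)     = ≈-sym (substS-closed (c n))
  substA-substS {σA} {σ} {σ'} c h (lam _ v) = lam (substA-substS (ClosedSubst-renS c) h' v)
    where h' : substA (renS suc ∘ σA) ∘ extsS σ' ≈ˢ extsS σ
          h' zero    = var
          h' (suc n) = renS-substA (σ' n) ⟨≈⟩ renS-resp-≈ (h n)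
  substA-substS c h (app s t)    = app (substA-substS c h s) (substA-substS c h t)
  substA-substS c h (! s)        = ≈-refl
  substA-substS {σA} {σ} {σ'} c h (lett _ s t) =
    lett (substA-substS c h s) (substA-substS (ClosedSubst-extsA c) h' t)
    where h' : substA (extsA σA) ∘ renA suc ∘ σ' ≈ˢ renA suc ∘ σ
          h' n = substA-extsA-renA-suc (σ' n) ⟨≈⟩ renA-resp-≈ (h n)
  substA-substS c h (TI θ)       = TI (λ ψ → substAM-substSM c h (θ ψ))

  substAM-substSM : ∀ {σA σ σ'} → ClosedSubst σA → substA σA ∘ σ' ≈ˢ σ → ∀ m
                  → substAM σA (substSM σ' m) ≈ᴹ substSM σ (substAM σA m)
  substAM-substSM c h nothing  = nothing
  substAM-substSM c h (just s) = just (substA-substS c h s)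

infixr 5 _∷ˢ_
_∷ˢ_ : Tm → (ℕ → Tm) → ℕ → Tm
(t ∷ˢ σ) zero    = t
(t ∷ˢ σ) (suc n) = σ n

[/a]≈substS : ∀ s t → s [ t /a] ≈ substS (t ∷ˢ var) s
[/a]≈substS s t = substS-resp-≈ˢ (λ { zero → ≈-refl ; (suc n) → var }) s

[/u]≈substA : ∀ s t → s [ t /u] ≈ substA (t ∷ˢ avar) s
[/u]≈substA s t = substA-resp-≈ˢ (λ { zero → ≈-refl ; (suc n) → avar }) s

WellScopedSubst-∷ˢ : ∀ {t σ} → WellScoped t → WellScopedSubst σ → WellScopedSubst (t ∷ˢ σ)
WellScopedSubst-∷ˢ wt ws zero    = wt
WellScopedSubst-∷ˢ wt ws (suc n) = ws n

WellScoped-var : ∀ n → WellScoped (var n)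
WellScoped-var n = suc n , var (s≤s ≤-refl)

WellScopedSubst-var : WellScopedSubst var
WellScopedSubst-var = WellScoped-var

ClosedSubst-∷ˢ : ∀ {t σ} → Scoped 0 t → ClosedSubst σ → ClosedSubst (t ∷ˢ σ)
ClosedSubst-∷ˢ d c zero    = d
ClosedSubst-∷ˢ d c (suc n) = c n

ClosedSubst-avar : ClosedSubst avar
ClosedSubst-avar n = avar

substS-∷ˢ-extsS : ∀ {t σ} → WellScopedSubst σ → substS (t ∷ˢ var) ∘ extsS σ ≈ˢ t ∷ˢ σ
substS-∷ˢ-extsS ws zero    = ≈-refl
substS-∷ˢ-extsS {σ = σ} ws (suc n) = substS-renS (proj₂ (ws n)) ⟨≈⟩ substS-var (λ _ → var) (σ n)

substA-∷ˢ-renA-suc : ∀ {t} x → substA (t ∷ˢ avar) (renA suc x) ≈ x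
substA-∷ˢ-renA-suc x = substA-renA x ⟨≈⟩ substA-avar (λ _ → avar) x

substA-∷ˢ-extsA : ∀ {t σ} → substA (t ∷ˢ avar) ∘ extsA σ ≈ˢ t ∷ˢ σ
substA-∷ˢ-extsA zero    = ≈-refl
substA-∷ˢ-extsA {σ = σ} (suc n) = substA-∷ˢ-renA-suc (σ n)

[/a]-substS-substA : ∀ {σS σA t} s → WellScopedSubst σS → ClosedSubst σA
                   → substS (extsS σS) (substA (renS suc ∘ σA) s) [ t /a] ≈ substS (t ∷ˢ σS) (substA σA s)
[/a]-substS-substA {σS} {σA} {t} s ws c = begin
  substS (extsS σS) s' [ t /a]
    ≈⟨ [/a]≈substS (substS (extsS σS) s') t ⟩
  substS (t ∷ˢ var) (substS (extsS σS) s')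
    ≈⟨ substS-substS (WellScopedSubst-extsS ws) s' ⟩
  substS (substS (t ∷ˢ var) ∘ extsS σS) s'
    ≈⟨ substS-cong (substS-∷ˢ-extsS ws) (substA-resp-≈ˢ (renS-closed ∘ c) s) ⟩
  substS (t ∷ˢ σS) (substA σA s) ∎
  where open ≈-Reasoning
        s' : Tm
        s' = substA (renS suc ∘ σA) s

[/u]-substS-substA : ∀ {σS σA r} t → Scoped 0 r
                   → substS (renA suc ∘ σS) (substA (extsA σA) t) [ r /u] ≈ substS σS (substA (r ∷ˢ σA) t)
[/u]-substS-substA {σS} {σA} {r} t dr = begin
  substS (renA suc ∘ σS) t' [ r /u]
    ≈⟨ [/u]≈substA (substS (renA suc ∘ σS) t') r ⟩
  substA (r ∷ˢ avar) (substS (renA suc ∘ σS) t')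
    ≈⟨ substA-substS (ClosedSubst-∷ˢ dr ClosedSubst-avar) (substA-∷ˢ-renA-suc ∘ σS) t' ⟩
  substS σS (substA (r ∷ˢ avar) t')
    ≈⟨ substS-resp-≈ (substA-substA t) ⟩
  substS σS (substA (substA (r ∷ˢ avar) ∘ extsA σA) t)
    ≈⟨ substS-resp-≈ (substA-resp-≈ˢ substA-∷ˢ-extsA t) ⟩
  substS σS (substA (r ∷ˢ σA) t) ∎
  where open ≈-Reasoning
        t' : Tm
        t' = substA (extsA σA) t

data Atomic : Label → Set where
  aRefl    : Atomic lRefl
  aBeta    : Atomic lBeta
  aBetaBox : Atomic lBetaBox
  aTi      : Atomic lTi
  aTrplNil : Atomic lTrplNil
  aD       : Atomic lD

data Binary : Label → Set where
  bTrans    : Binary lTrans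
  bApp      : Binary lApp
  bLet      : Binary lLet
  bTrplCons : Binary lTrplCons

module EvalT-Related
  (E : Label → Tm → Tm → Set) (S : Tm → Tm → Set)
  (atomic : ∀ {ψ a b} → Atomic ψ → E ψ a b → S a b)
  (binary : ∀ {ψ f f' x x' y y'} → Binary ψ → E ψ f f' → S x x' → S y y'
          → S (app (app f x) y) (app (app f' x') y'))
  (unary  : ∀ {f f' x x'} → E lLam f f' → S x x' → S (app f x) (app f' x'))
  {θ θ' : LMap} (entries : ∀ ψ → Pointwise (E ψ) (θ ψ) (θ' ψ))
  where

  default : Pointwise S (θ lD) (θ' lD)
  default with θ lD | θ' lD | entries lD
  ... | _ | _ | just e  = just (atomic aD e)
  ... | _ | _ | nothing = nothing

  atom : ∀ {ψ} → Atomic ψ → Pointwise S (θ ψ <∣> θ lD) (θ' ψ <∣> θ' lD)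
  atom {ψ} a with θ ψ | θ' ψ | entries ψ
  ... | _ | _ | just e  = just (atomic a e)
  ... | _ | _ | nothing = default

  mutual
    evalT-related : ∀ q → Pointwise S (evalT q θ) (evalT q θ')
    evalT-related (refl _)    = atom aRefl
    evalT-related (β _ _ _)   = atom aBeta
    evalT-related (β□ _ _ _)  = atom aBetaBox
    evalT-related (ti _ _)    = atom aTi
    evalT-related (trpl ζ)    = evalZ-related ζ allLabels
    evalT-related (trans q₁ q₂) with θ lTrans | θ' lTrans | entries lTrans
    ... | _ | _ | nothing = default
    ... | _ | _ | just e with evalT q₁ θ | evalT q₁ θ' | evalT-related q₁
                            | evalT q₂ θ | evalT q₂ θ' | evalT-related q₂
    ...   | _ | _ | just x  | _ | _ | just y  = just (binary bTrans e x y)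
    ...   | _ | _ | just _  | _ | _ | nothing = nothing
    ...   | _ | _ | nothing | _ | _ | _       = nothing
    evalT-related (appT q₁ q₂) with θ lApp | θ' lApp | entries lApp
    ... | _ | _ | nothing = default
    ... | _ | _ | just e with evalT q₁ θ | evalT q₁ θ' | evalT-related q₁
                            | evalT q₂ θ | evalT q₂ θ' | evalT-related q₂
    ...   | _ | _ | just x  | _ | _ | just y  = just (binary bApp e x y)
    ...   | _ | _ | just _  | _ | _ | nothing = nothing
    ...   | _ | _ | nothing | _ | _ | _       = nothing
    evalT-related (letT q₁ _ q₂) with θ lLet | θ' lLet | entries lLet
    ... | _ | _ | nothing = default
    ... | _ | _ | just e with evalT q₁ θ | evalT q₁ θ' | evalT-related q₁
                            | evalT q₂ θ | evalT q₂ θ' | evalT-related q₂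
    ...   | _ | _ | just x  | _ | _ | just y  = just (binary bLet e x y)
    ...   | _ | _ | just _  | _ | _ | nothing = nothing
    ...   | _ | _ | nothing | _ | _ | _       = nothing
    evalT-related (lamT _ q₁) with θ lLam | θ' lLam | entries lLam
    ... | _ | _ | nothing = default
    ... | _ | _ | just e with evalT q₁ θ | evalT q₁ θ' | evalT-related q₁
    ...   | _ | _ | just x  = just (unary e x)
    ...   | _ | _ | nothing = nothing

    evalZ-related : ∀ ζ ls → Pointwise S (evalZ ζ ls θ) (evalZ ζ ls θ')
    evalZ-related ζ []       = atom aTrplNil
    evalZ-related ζ (l ∷ ls) = evalZ'-related ζ ls (ζ l)

    evalZ'-related : ∀ ζ ls m → Pointwise S (evalZ' ζ ls θ m) (evalZ' ζ ls θ' m)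
    evalZ'-related ζ ls nothing  = evalZ-related ζ ls
    evalZ'-related ζ ls (just q) with θ lTrplCons | θ' lTrplCons | entries lTrplCons
    ... | _ | _ | nothing = default
    ... | _ | _ | just e with evalT q θ | evalT q θ' | evalT-related q
                            | evalZ ζ ls θ | evalZ ζ ls θ' | evalZ-related ζ ls
    ...   | _ | _ | just x  | _ | _ | just y  = just (binary bTrplCons e x y)
    ...   | _ | _ | just _  | _ | _ | nothing = nothing
    ...   | _ | _ | nothing | _ | _ | _       = nothing

  evalT-just : ∀ q {r} → evalT q θ ≡ just r → ∃[ r' ] evalT q θ' ≡ just r' × S r r'
  evalT-just q eq = just-inv (subst (λ m → Pointwise S m (evalT q θ')) eq (evalT-related q))

evalT-resp : (R : Tm → Tm → Set) → (∀ {f f' x x'} → R f f' → R x x' → R (app f x) (app f' x'))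
           → ∀ {θ θ'} → (∀ ψ → Pointwise R (θ ψ) (θ' ψ))
           → ∀ q {r} → evalT q θ ≡ just r → ∃[ r' ] evalT q θ' ≡ just r' × R r r'
evalT-resp R R-app =
  EvalT-Related.evalT-just (λ _ → R) R (λ _ e → e) (λ _ e x y → R-app (R-app e x) y) R-app

AllEntries : (Label → Tm → Set) → LMap → Set
AllEntries Q θ = ∀ ψ r → θ ψ ≡ just r → Q ψ r

evalT-invariant : (U : Label → Tm → Set) (Q : Tm → Set)
                → (∀ {ψ r} → Atomic ψ → U ψ r → Q r)
                → (∀ {ψ f x y} → Binary ψ → U ψ f → Q x → Q y → Q (app (app f x) y))
                → (∀ {f x} → U lLam f → Q x → Q (app f x))
                → ∀ {θ} → AllEntries U θ → ∀ q {r} → evalT q θ ≡ just r → Q r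
evalT-invariant U Q atomic binary unary {θ} all q eq =
  proj₂ (proj₂ (EvalT-Related.evalT-just (λ ψ a _ → U ψ a) (λ a _ → Q a)
                                         atomic binary unary entries q eq))
  where entries : ∀ ψ → Pointwise (λ a _ → U ψ a) (θ ψ) (θ ψ)
        entries ψ with θ ψ in eq
        ... | just r  = just (all ψ r eq)
        ... | nothing = nothing

_[_↦_] : LMap → Label → Tm → LMap
(θ [ ψ ↦ s ]) ψ' with ψ' ≟ᴸ ψ
... | yes _ = just s
... | no _  = θ ψ'

[↦]-hit : ∀ θ ψ s → (θ [ ψ ↦ s ]) ψ ≡ just s
[↦]-hit θ ψ s with ψ ≟ᴸ ψ
... | yes _ = refl
... | no ψ≢ψ = ⊥-elim (ψ≢ψ refl)

[↦]-miss : ∀ θ ψ s ψ' → ψ' ≢ ψ → (θ [ ψ ↦ s ]) ψ' ≡ θ ψ'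
[↦]-miss θ ψ s ψ' ψ'≢ψ with ψ' ≟ᴸ ψ
... | yes ψ'≡ψ = ⊥-elim (ψ'≢ψ ψ'≡ψ)
... | no _     = refl

record StepAt (ψ : Label) (θ θ' : LMap) : Set where
  constructor stepAt
  field
    {before after} : Tm
    before≡ : θ ψ ≡ just before
    step    : before ⟶ after
    after≡  : θ' ψ ≡ just after
    others  : ∀ ψ' → ψ' ≢ ψ → θ' ψ' ≡ θ ψ'

ξTI-at : ∀ {ψ θ θ'} → StepAt ψ θ θ' → TI θ ⟶ TI θ'
ξTI-at (stepAt b≡ st a≡ others) = ξTI _ b≡ st a≡ others

StepAt-preserves : ∀ {Q : Label → Tm → Set} {ψ θ θ'} (st : StepAt ψ θ θ')
                 → (Q ψ (StepAt.before st) → Q ψ (StepAt.after st)) → AllEntries Q θ → AllEntries Q θ'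
StepAt-preserves {Q} {ψ} (stepAt b≡ st a≡ others) Q-step all ψ' r eq with ψ' ≟ᴸ ψ
... | yes refl = subst (Q ψ) (just-injective (≡-trans (sym a≡) eq)) (Q-step (all ψ _ b≡))
... | no ψ'≢ψ  = all ψ' r (≡-trans (sym (others ψ' ψ'≢ψ)) eq)

StepAt-simulate : ∀ {R : Tm → Tm → Set} {ψ θ θ' θ₁} (st : StepAt ψ θ θ')
                → (∀ ψ' → Pointwise R (θ ψ') (θ₁ ψ'))
                → (∀ {s₁} → R (StepAt.before st) s₁ → ∃[ s₁' ] s₁ ⟶ s₁' × R (StepAt.after st) s₁')
                → ∃[ θ₁' ] StepAt ψ θ₁ θ₁' × (∀ ψ' → Pointwise R (θ' ψ') (θ₁' ψ'))
StepAt-simulate {R} {ψ} {θ' = θ'} {θ₁} (stepAt b≡ st a≡ others) related simulate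
  with just-inv (subst (λ m → Pointwise R m (θ₁ ψ)) b≡ (related ψ))
... | s₁ , θ₁ψ≡s₁ , r with simulate r
... | s₁' , st₁ , r' =
  θ₁ [ ψ ↦ s₁' ] , stepAt θ₁ψ≡s₁ st₁ ([↦]-hit θ₁ ψ s₁') ([↦]-miss θ₁ ψ s₁') , related'
  where related' : ∀ ψ' → Pointwise R (θ' ψ') ((θ₁ [ ψ ↦ s₁' ]) ψ')
        related' ψ' with ψ' ≟ᴸ ψ
        ... | yes refl = subst (λ m → Pointwise R m (just s₁')) (sym a≡) (just r')
        ... | no ψ'≢ψ  = subst (λ m → Pointwise R m (θ₁ ψ')) (sym (others ψ' ψ'≢ψ)) (related ψ')

_⟶*_ : Tm → Tm → Set
_⟶*_ = Star _⟶_

⟶-resp-≈ : ∀ {s s₁ t} → s ≈ s₁ → s ⟶ t → ∃[ t₁ ] s₁ ⟶ t₁ × t ≈ t₁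
⟶-resp-≈ (app {t = u} {t' = u₁} (lam {s = b} {s' = b₁} e) f) βstep =
  b₁ [ u₁ /a] , βstep ,
  ([/a]≈substS b u ⟨≈⟩ substS-cong (λ { zero → f ; (suc n) → var }) e ⟨≈⟩ ≈-sym ([/a]≈substS b₁ u₁))
⟶-resp-≈ (lett {t = b} {t' = b₁} (box {s = r} {s' = r₁} e) f) β□step =
  b₁ [ r₁ /u] , β□step ,
  ([/u]≈substA b r ⟨≈⟩ substA-cong (λ { zero → e ; (suc n) → avar }) f ⟨≈⟩ ≈-sym ([/u]≈substA b₁ r₁))
⟶-resp-≈ (TI h) (TIstep q eq) with evalT-resp _≈_ app h q eq
... | r₁ , eq₁ , e = r₁ , TIstep q eq₁ , e
⟶-resp-≈ (TI h) (ξTI ψ b≡ st a≡ others)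
  with StepAt-simulate (stepAt b≡ st a≡ others) h (λ e → ⟶-resp-≈ e st)
... | θ₁' , st₁ , h' = TI θ₁' , ξTI-at st₁ , TI h'
⟶-resp-≈ (lam e) (ξlam st) with ⟶-resp-≈ e st
... | t₁ , st₁ , e' = lam _ t₁ , ξlam st₁ , lam e'
⟶-resp-≈ (app e f) (ξappₗ st) with ⟶-resp-≈ e st
... | t₁ , st₁ , e' = app t₁ _ , ξappₗ st₁ , app e' f
⟶-resp-≈ (app e f) (ξappᵣ st) with ⟶-resp-≈ f st
... | t₁ , st₁ , f' = app _ t₁ , ξappᵣ st₁ , app e f'
⟶-resp-≈ (box e) (ξbox st) with ⟶-resp-≈ e st
... | t₁ , st₁ , e' = (! t₁) , ξbox st₁ , box e'
⟶-resp-≈ (lett e f) (ξletₗ st) with ⟶-resp-≈ e st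
... | t₁ , st₁ , e' = lett _ t₁ _ , ξletₗ st₁ , lett e' f
⟶-resp-≈ (lett e f) (ξletᵣ st) with ⟶-resp-≈ f st
... | t₁ , st₁ , f' = lett _ _ t₁ , ξletᵣ st₁ , lett e f'

⟶*-resp-≈ : ∀ {s s₁ t} → s ≈ s₁ → s ⟶* t → ∃[ t₁ ] s₁ ⟶* t₁ × t ≈ t₁
⟶*-resp-≈ e ε = _ , ε , e
⟶*-resp-≈ e (st ◅ sts) with ⟶-resp-≈ e st
... | t₁ , st₁ , e' with ⟶*-resp-≈ e' sts
... | t₂ , sts₁ , e'' = t₂ , st₁ ◅ sts₁ , e''

SN-resp-≈ : ∀ {s s'} → SN s → s ≈ s' → SN s'
SN-resp-≈ (acc rs) e = acc λ st' →
  let t , st , e' = ⟶-resp-≈ (≈-sym e) st' in SN-resp-≈ (rs st) (≈-sym e')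

Scoped-⟶ : ∀ {k s s'} → Scoped k s → s ⟶ s' → Scoped k s'
Scoped-⟶ (app (lam db) du) βstep = Scoped-substS (λ { zero _ → du ; (suc n) (s≤s lt) → var lt }) db
Scoped-⟶ (lett (box dr) db) β□step = Scoped-substA (λ { zero → dr ; (suc n) → avar }) db
Scoped-⟶ {k} (TI d) (TIstep q eq) =
  evalT-invariant (λ _ → Scoped k) (Scoped k) (λ _ d → d) (λ _ df dx dy → app (app df dx) dy) app d q eq
Scoped-⟶ (TI d) (ξTI ψ b≡ st a≡ others) =
  TI (StepAt-preserves (stepAt b≡ st a≡ others) (λ d' → Scoped-⟶ d' st) d)
Scoped-⟶ (lam d)    (ξlam st)  = lam (Scoped-⟶ d st)
Scoped-⟶ (app d e)  (ξappₗ st) = app (Scoped-⟶ d st) e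
Scoped-⟶ (app d e)  (ξappᵣ st) = app d (Scoped-⟶ e st)
Scoped-⟶ (box d)    (ξbox st)  = box (Scoped-⟶ d st)
Scoped-⟶ (lett d e) (ξletₗ st) = lett (Scoped-⟶ d st) e
Scoped-⟶ (lett d e) (ξletᵣ st) = lett d (Scoped-⟶ e st)

substSM-graph : ∀ σ m → Pointwise (λ a b → b ≈ substS σ a) m (substSM σ m)
substSM-graph σ nothing  = nothing
substSM-graph σ (just a) = just ≈-refl

substSM-graph⁻ : ∀ {σ m m₁} → Pointwise (λ a b → b ≈ substS σ a) m m₁ → m₁ ≈ᴹ substSM σ m
substSM-graph⁻ nothing  = nothing
substSM-graph⁻ (just e) = just e

substAM-graph : ∀ σ m → Pointwise (λ a b → b ≈ substA σ a) m (substAM σ m)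
substAM-graph σ nothing  = nothing
substAM-graph σ (just a) = just ≈-refl

substAM-graph⁻ : ∀ {σ m m₁} → Pointwise (λ a b → b ≈ substA σ a) m m₁ → m₁ ≈ᴹ substAM σ m
substAM-graph⁻ nothing  = nothing
substAM-graph⁻ (just e) = just e

⟶-along-≈ : ∀ {s₁ t r t'} → s₁ ≈ t → t ⟶ r → r ≈ t' → ∃[ s₁' ] s₁ ⟶ s₁' × s₁' ≈ t'
⟶-along-≈ e st e' with ⟶-resp-≈ (≈-sym e) st
... | s₁' , st₁ , e'' = s₁' , st₁ , ≈-sym e'' ⟨≈⟩ e'

∷ˢ-substS : ∀ {σ u} → substS σ u ∷ˢ σ ≈ˢ substS σ ∘ (u ∷ˢ var)
∷ˢ-substS zero    = ≈-refl
∷ˢ-substS (suc n) = ≈-refl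

∷ˢ-substA : ∀ {σ u} → substA σ u ∷ˢ σ ≈ˢ substA σ ∘ (u ∷ˢ avar)
∷ˢ-substA zero    = ≈-refl
∷ˢ-substA (suc n) = ≈-refl

substA-∷ˢ-var : ∀ {σ u} → substA σ ∘ (u ∷ˢ var) ≈ˢ substA σ u ∷ˢ var
substA-∷ˢ-var zero    = ≈-refl
substA-∷ˢ-var (suc n) = var

substS-⟶ : ∀ {k σ s s'} → WellScopedSubst σ → Scoped k s → s ⟶ s'
         → ∃[ r ] substS σ s ⟶ r × r ≈ substS σ s'
substS-⟶ {k} {σ} ws (app (lam _) du) (βstep {s = b} {t = u}) = _ , βstep , (begin
  substS (extsS σ) b [ substS σ u /a]
    ≈⟨ [/a]≈substS (substS (extsS σ) b) (substS σ u) ⟩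
  substS (substS σ u ∷ˢ var) (substS (extsS σ) b)
    ≈⟨ substS-substS (WellScopedSubst-extsS ws) b ⟩
  substS (substS (substS σ u ∷ˢ var) ∘ extsS σ) b
    ≈⟨ substS-resp-≈ˢ (λ n → substS-∷ˢ-extsS ws n ⟨≈⟩ ∷ˢ-substS n) b ⟩
  substS (substS σ ∘ (u ∷ˢ var)) b
    ≈⟨ substS-substS (WellScopedSubst-∷ˢ (k , du) WellScopedSubst-var) b ⟨
  substS σ (substS (u ∷ˢ var) b)
    ≈⟨ substS-resp-≈ ([/a]≈substS b u) ⟨
  substS σ (b [ u /a]) ∎)
  where open ≈-Reasoning
substS-⟶ {σ = σ} ws (lett (box dr) _) (β□step {s = r} {t = b}) = _ , β□step , (begin
  substS (renA suc ∘ σ) b [ r /u]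
    ≈⟨ [/u]≈substA (substS (renA suc ∘ σ) b) r ⟩
  substA (r ∷ˢ avar) (substS (renA suc ∘ σ) b)
    ≈⟨ substA-substS (ClosedSubst-∷ˢ dr ClosedSubst-avar) (substA-∷ˢ-renA-suc ∘ σ) b ⟩
  substS σ (substA (r ∷ˢ avar) b)
    ≈⟨ substS-resp-≈ ([/u]≈substA b r) ⟨
  substS σ (b [ r /u]) ∎)
  where open ≈-Reasoning
substS-⟶ {σ = σ} ws (TI {θ = θ} d) (TIstep q eq)
  with evalT-resp (λ a b → b ≈ substS σ a) app (substSM-graph σ ∘ θ) q eq
... | r , eq' , e = r , TIstep q eq' , e
substS-⟶ {σ = σ} ws (TI {θ = θ} d) (ξTI {s = s} {s'} ψ b≡ st a≡ others)
  with StepAt-simulate (stepAt b≡ st a≡ others) (substSM-graph σ ∘ θ) follow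
  where follow : ∀ {s₁} → s₁ ≈ substS σ s → ∃[ s₁' ] s₁ ⟶ s₁' × s₁' ≈ substS σ s'
        follow e with substS-⟶ ws (d ψ _ b≡) st
        ... | r , st' , e' = ⟶-along-≈ e st' e'
... | θ₁' , st₁ , h = TI θ₁' , ξTI-at st₁ , TI (substSM-graph⁻ ∘ h)
substS-⟶ ws (lam d) (ξlam st) with substS-⟶ (WellScopedSubst-extsS ws) d st
... | r , st' , e = lam _ r , ξlam st' , lam e
substS-⟶ ws (app d _) (ξappₗ st) with substS-⟶ ws d st
... | r , st' , e = app r _ , ξappₗ st' , app e ≈-refl
substS-⟶ ws (app _ d) (ξappᵣ st) with substS-⟶ ws d st
... | r , st' , e = app _ r , ξappᵣ st' , app ≈-refl e
substS-⟶ ws (box d) (ξbox st) = _ , ξbox st , ≈-refl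
substS-⟶ ws (lett d _) (ξletₗ st) with substS-⟶ ws d st
... | r , st' , e = lett _ r _ , ξletₗ st' , lett e ≈-refl
substS-⟶ ws (lett _ d) (ξletᵣ st) with substS-⟶ (WellScopedSubst-renA ws) d st
... | r , st' , e = lett _ _ r , ξletᵣ st' , lett ≈-refl e

substA-⟶ : ∀ {σ s s'} → ClosedSubst σ → s ⟶ s' → ∃[ r ] substA σ s ⟶ r × r ≈ substA σ s'
substA-⟶ {σ} c (βstep {s = b} {t = u}) = _ , βstep , (begin
  substA (renS suc ∘ σ) b [ substA σ u /a]
    ≈⟨ [/a]≈substS (substA (renS suc ∘ σ) b) (substA σ u) ⟩
  substS (substA σ u ∷ˢ var) (substA (renS suc ∘ σ) b)
    ≈⟨ substS-resp-≈ (substA-resp-≈ˢ (renS-closed ∘ c) b) ⟩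
  substS (substA σ u ∷ˢ var) (substA σ b)
    ≈⟨ substA-substS c substA-∷ˢ-var b ⟨
  substA σ (substS (u ∷ˢ var) b)
    ≈⟨ substA-resp-≈ ([/a]≈substS b u) ⟨
  substA σ (b [ u /a]) ∎)
  where open ≈-Reasoning
substA-⟶ {σ} c (β□step {s = r} {t = b}) = _ , β□step , (begin
  substA (extsA σ) b [ substA σ r /u]
    ≈⟨ [/u]≈substA (substA (extsA σ) b) (substA σ r) ⟩
  substA (substA σ r ∷ˢ avar) (substA (extsA σ) b)
    ≈⟨ substA-substA b ⟩
  substA (substA (substA σ r ∷ˢ avar) ∘ extsA σ) b
    ≈⟨ substA-resp-≈ˢ (λ n → substA-∷ˢ-extsA n ⟨≈⟩ ∷ˢ-substA n) b ⟩
  substA (substA σ ∘ (r ∷ˢ avar)) b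
    ≈⟨ substA-substA b ⟨
  substA σ (substA (r ∷ˢ avar) b)
    ≈⟨ substA-resp-≈ ([/u]≈substA b r) ⟨
  substA σ (b [ r /u]) ∎)
  where open ≈-Reasoning
substA-⟶ {σ} c (TIstep {θ = θ} q eq)
  with evalT-resp (λ a b → b ≈ substA σ a) app (substAM-graph σ ∘ θ) q eq
... | r , eq' , e = r , TIstep q eq' , e
substA-⟶ {σ} c (ξTI {θ = θ} {s = s} {s'} ψ b≡ st a≡ others)
  with StepAt-simulate (stepAt b≡ st a≡ others) (substAM-graph σ ∘ θ) follow
  where follow : ∀ {s₁} → s₁ ≈ substA σ s → ∃[ s₁' ] s₁ ⟶ s₁' × s₁' ≈ substA σ s'
        follow e with substA-⟶ c st
        ... | r , st' , e' = ⟶-along-≈ e st' e'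
... | θ₁' , st₁ , h = TI θ₁' , ξTI-at st₁ , TI (substAM-graph⁻ ∘ h)
substA-⟶ c (ξlam st) with substA-⟶ (ClosedSubst-renS c) st
... | r , st' , e = lam _ r , ξlam st' , lam e
substA-⟶ c (ξappₗ st) with substA-⟶ c st
... | r , st' , e = app r _ , ξappₗ st' , app e ≈-refl
substA-⟶ c (ξappᵣ st) with substA-⟶ c st
... | r , st' , e = app _ r , ξappᵣ st' , app ≈-refl e
substA-⟶ c (ξbox st) with substA-⟶ c st
... | r , st' , e = (! r) , ξbox st' , box e
substA-⟶ c (ξletₗ st) with substA-⟶ c st
... | r , st' , e = lett _ r _ , ξletₗ st' , lett e ≈-refl
substA-⟶ c (ξletᵣ st) with substA-⟶ (ClosedSubst-extsA c) st
... | r , st' , e = lett _ _ r , ξletᵣ st' , lett ≈-refl e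

SN-reflect : ∀ (I : Tm → Set) (f : Tm → Tm)
           → (∀ {s s'} → I s → s ⟶ s' → I s')
           → (∀ {s s'} → I s → s ⟶ s' → ∃[ r ] f s ⟶ r × r ≈ f s')
           → ∀ {s} → I s → SN (f s) → SN s
SN-reflect I f I-⟶ f-⟶ i sn = go sn i ≈-refl
  where go : ∀ {t s} → SN t → I s → f s ≈ t → SN s
        go (acc rs) i e = acc λ st →
          let r , fst , e' = f-⟶ i st
              t' , st' , e'' = ⟶-resp-≈ e fst
          in go (rs st') (I-⟶ i st) (≈-sym e' ⟨≈⟩ e'')

SN-substS⁻ : ∀ {k σ s} → WellScopedSubst σ → Scoped k s → SN (substS σ s) → SN s
SN-substS⁻ {k} {σ} ws = SN-reflect (Scoped k) (substS σ) Scoped-⟶ (substS-⟶ ws)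

SN-substA⁻ : ∀ {σ s} → ClosedSubst σ → SN (substA σ s) → SN s
SN-substA⁻ {σ} c = SN-reflect (λ _ → ⊤) (substA σ) _ (λ _ → substA-⟶ c) tt

-- Reducibility candidates

-- Arguments are required to be well scoped so that substitution into a
-- reducible body commutes with reduction (substS-⟶).
Red : Ty → Tm → Set
Red (P _)   s = SN s
Red (τ ⊃ σ) s = ∀ t → WellScoped t → Red τ t → Red σ (app s t)
Red (□ τ)   s = SN s × (∀ r → s ⟶* (! r) → Red τ r)

data Neutral : Tm → Set where
  var  : ∀ {n} → Neutral (var n)
  avar : ∀ {n} → Neutral (avar n)
  app  : ∀ {s t} → Neutral (app s t)
  lett : ∀ {τ s t} → Neutral (lett τ s t)
  TI   : ∀ {θ} → Neutral (TI θ)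

WellScoped-⟶ : ∀ {s s'} → WellScoped s → s ⟶ s' → WellScoped s'
WellScoped-⟶ (k , d) st = k , Scoped-⟶ d st

SN-⟶ : ∀ {s s'} → SN s → s ⟶ s' → SN s'
SN-⟶ (acc rs) st = rs st

SN-app⁻ : ∀ {s t} → SN (app s t) → SN s
SN-app⁻ (acc rs) = acc λ st → SN-app⁻ (rs (ξappₗ st))

SN-box : ∀ {s} → SN s → SN (! s)
SN-box (acc rs) = acc λ { (ξbox st) → SN-box (rs st) }

Red-⟶ : ∀ τ {s s'} → s ⟶ s' → Red τ s → Red τ s'
Red-⟶ (P _)   st r         = SN-⟶ r st
Red-⟶ (τ ⊃ σ) st r         = λ t wt rt → Red-⟶ σ (ξappₗ st) (r t wt rt)
Red-⟶ (□ τ)   st (sn , rb) = SN-⟶ sn st , λ r sts → rb r (st ◅ sts)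

Red-⟶* : ∀ τ {s s'} → s ⟶* s' → Red τ s → Red τ s'
Red-⟶* τ ε           r = r
Red-⟶* τ (st ◅ sts) r = Red-⟶* τ sts (Red-⟶ τ st r)

Red-resp-≈ : ∀ τ {s s'} → s ≈ s' → Red τ s → Red τ s'
Red-resp-≈ (P _)   e r         = SN-resp-≈ r e
Red-resp-≈ (τ ⊃ σ) e r         = λ t wt rt → Red-resp-≈ σ (app e ≈-refl) (r t wt rt)
Red-resp-≈ (□ τ)   e (sn , rb) = SN-resp-≈ sn e , rb'
  where rb' : ∀ r → _ ⟶* (! r) → Red τ r
        rb' r sts with ⟶*-resp-≈ (≈-sym e) sts
        ... | .(! _) , sts' , box e' = Red-resp-≈ τ (≈-sym e') (rb _ sts')

app-neutral-⟶ : ∀ {s t u} → Neutral s → app s t ⟶ u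
              → (∃[ s' ] s ⟶ s' × u ≡ app s' t) ⊎ (∃[ t' ] t ⟶ t' × u ≡ app s t')
app-neutral-⟶ () βstep
app-neutral-⟶ _ (ξappₗ st) = inj₁ (_ , st , refl)
app-neutral-⟶ _ (ξappᵣ st) = inj₂ (_ , st , refl)

neutral-⟶*-box : ∀ {s r} → Neutral s → s ⟶* (! r) → ∃[ s' ] s ⟶ s' × s' ⟶* (! r)
neutral-⟶*-box () ε
neutral-⟶*-box _ (st ◅ sts) = _ , st , sts

mutual
  Red⇒SN : ∀ τ {s} → Red τ s → SN s
  Red⇒SN (P _)   r = r
  Red⇒SN (τ ⊃ σ) r = SN-app⁻ (Red⇒SN σ (r (var 0) (WellScoped-var 0) (Red-neutral τ var (λ ()))))
  Red⇒SN (□ τ)   r = proj₁ r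

  Red-neutral : ∀ τ {s} → Neutral s → (∀ {s'} → s ⟶ s' → Red τ s') → Red τ s
  Red-neutral (P _)   ne h = acc h
  Red-neutral (τ ⊃ σ) {s} ne h t wt rt = go (Red⇒SN τ rt) wt rt
    where go : ∀ {t} → SN t → WellScoped t → Red τ t → Red σ (app s t)
          go {t} (acc rs) wt rt = Red-neutral σ app next
            where next : ∀ {u} → app s t ⟶ u → Red σ u
                  next st with app-neutral-⟶ ne st
                  ... | inj₁ (_ , st' , refl) = h st' t wt rt
                  ... | inj₂ (_ , st' , refl) = go (rs st') (WellScoped-⟶ wt st') (Red-⟶ τ st' rt)
  Red-neutral (□ τ) ne h = acc (proj₁ ∘ h) , λ r sts →
    let _ , st , sts' = neutral-⟶*-box ne sts in proj₂ (h st) r sts'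

Red-var : ∀ τ {n} → Red τ (var n)
Red-var τ = Red-neutral τ var (λ ())

Red-avar : ∀ τ {n} → Red τ (avar n)
Red-avar τ = Red-neutral τ avar (λ ())

Red-⟶≈ : ∀ τ {s r s'} → s ⟶ r → r ≈ s' → Red τ s → Red τ s'
Red-⟶≈ τ st e = Red-resp-≈ τ e ∘ Red-⟶ τ st

[/a]-⟶ : ∀ {k b b' t} → Scoped k b → WellScoped t → b ⟶ b' → ∃[ r ] b [ t /a] ⟶ r × r ≈ b' [ t /a]
[/a]-⟶ {b = b} {b'} {t} d wt st with substS-⟶ (WellScopedSubst-∷ˢ wt WellScopedSubst-var) d st
... | r , st' , e = ⟶-along-≈ ([/a]≈substS b t) st' (e ⟨≈⟩ ≈-sym ([/a]≈substS b' t))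

[/u]-⟶ : ∀ {b b' r} → Scoped 0 r → b ⟶ b' → ∃[ x ] b [ r /u] ⟶ x × x ≈ b' [ r /u]
[/u]-⟶ {b} {b'} {r} dr st with substA-⟶ (ClosedSubst-∷ˢ dr ClosedSubst-avar) st
... | x , st' , e = ⟶-along-≈ ([/u]≈substA b r) st' (e ⟨≈⟩ ≈-sym ([/u]≈substA b' r))

Red-lam : ∀ τ σ {k b} → Scoped (suc k) b → (∀ t → WellScoped t → Red τ t → Red σ (b [ t /a]))
        → Red (τ ⊃ σ) (lam τ b)
Red-lam τ σ {k} {b} db red-body t wt rt = go SN-body (Red⇒SN τ rt) db red-body wt rt
  where
    SN-body : SN b
    SN-body =
      SN-substS⁻ (WellScopedSubst-∷ˢ (WellScoped-var 0) WellScopedSubst-var) db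
        (SN-resp-≈ (Red⇒SN σ (red-body (var 0) (WellScoped-var 0) (Red-var τ))) ([/a]≈substS b (var 0)))
    go : ∀ {b t} → SN b → SN t → Scoped (suc k) b → (∀ t → WellScoped t → Red τ t → Red σ (b [ t /a]))
       → WellScoped t → Red τ t → Red σ (app (lam τ b) t)
    go {b} {t} (acc rs-b) (acc rs-t) db red-body wt rt = Red-neutral σ app next
      where
        next : ∀ {u} → app (lam τ b) t ⟶ u → Red σ u
        next βstep                       = red-body t wt rt
        next (ξappₗ (ξlam {s' = b'} st)) = go (rs-b st) (acc rs-t) (Scoped-⟶ db st) red-body' wt rt
          where red-body' : ∀ t → WellScoped t → Red τ t → Red σ (b' [ t /a])
                red-body' t' wt' rt' =
                  let _ , st' , e = [/a]-⟶ db wt' st in Red-⟶≈ σ st' e (red-body t' wt' rt')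
        next (ξappᵣ st)                  = go (acc rs-b) (rs-t st) db red-body (WellScoped-⟶ wt st) (Red-⟶ τ st rt)

Scoped-unbox : ∀ {k r} → Scoped k (! r) → Scoped 0 r
Scoped-unbox (box d) = d

Red-let : ∀ τ σ {s b} → Red (□ τ) s → WellScoped s → (∀ r → Scoped 0 r → Red τ r → Red σ (b [ r /u]))
        → Red σ (lett τ s b)
Red-let τ σ {b = b} rs ws red-body = go (proj₁ rs) SN-body rs ws red-body
  where
    SN-body : SN b
    SN-body = SN-substA⁻ (ClosedSubst-∷ˢ avar ClosedSubst-avar)
                (SN-resp-≈ (Red⇒SN σ (red-body (avar 0) avar (Red-avar τ))) ([/u]≈substA b (avar 0)))
    go : ∀ {s b} → SN s → SN b → Red (□ τ) s → WellScoped s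
       → (∀ r → Scoped 0 r → Red τ r → Red σ (b [ r /u])) → Red σ (lett τ s b)
    go {s} {b} (acc rs-s) (acc rs-b) rs ws red-body = Red-neutral σ lett next
      where
        next : ∀ {u} → lett τ s b ⟶ u → Red σ u
        next (β□step {s = r})     = red-body r (Scoped-unbox (proj₂ ws)) (proj₂ rs r ε)
        next (ξletₗ st)           = go (rs-s st) (acc rs-b) (Red-⟶ (□ τ) st rs) (WellScoped-⟶ ws st) red-body
        next (ξletᵣ {t' = b'} st) = go (acc rs-s) (rs-b st) rs ws red-body'
          where red-body' : ∀ r → Scoped 0 r → Red τ r → Red σ (b' [ r /u])
                red-body' r dr rr = let _ , st' , e = [/u]-⟶ dr st in Red-⟶≈ σ st' e (red-body r dr rr)

StepIn : List Label → LMap → LMap → Set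
StepIn L θ θ' = ∃[ ψ ] ψ ∈ L × StepAt ψ θ θ'

_⟶ᴹ_ : Maybe Tm → Maybe Tm → Set
m ⟶ᴹ m' = ∃[ s ] ∃[ s' ] m ≡ just s × m' ≡ just s' × s ⟶ s'

SNᴹ : Maybe Tm → Set
SNᴹ = Acc (flip _⟶ᴹ_)

SN⇒SNᴹ : ∀ m → (∀ r → m ≡ just r → SN r) → SNᴹ m
SN⇒SNᴹ nothing  _  = acc λ { (_ , _ , () , _) }
SN⇒SNᴹ (just s) sn = go (sn s refl)
  where go : ∀ {s} → SN s → SNᴹ (just s)
        go (acc rs) = acc λ { (_ , _ , refl , refl , st) → go (rs st) }

SN-entries : LMap → Set
SN-entries = AllEntries (λ _ → SN)

SN-entries-⟶ : ∀ {ψ θ θ'} → StepAt ψ θ θ' → SN-entries θ → SN-entries θ'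
SN-entries-⟶ st = StepAt-preserves st (λ sn → SN-⟶ sn (StepAt.step st))

-- Lexicographic in the entries, ordered as in L: a step at the head
-- label decreases its entry, a step elsewhere leaves it unchanged.
SN-entries⇒Acc : ∀ L {θ} → SN-entries θ → Acc (flip (StepIn L)) θ
SN-entries⇒Acc []      _   = acc λ { (_ , () , _) }
SN-entries⇒Acc (l ∷ L) {θ} sn = outer (SN⇒SNᴹ (θ l) (sn l)) refl sn
  where
    outer : ∀ {m θ} → SNᴹ m → θ l ≡ m → SN-entries θ → Acc (flip (StepIn (l ∷ L))) θ
    outer {m} (acc rs-l) θl≡m sn = inner (SN-entries⇒Acc L sn) θl≡m sn
      where
        inner : ∀ {θ} → Acc (flip (StepIn L)) θ → θ l ≡ m → SN-entries θ → Acc (flip (StepIn (l ∷ L))) θ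
        inner (acc rs-L) θl≡m sn = acc λ where
          (ψ , ψ∈ , st@(stepAt b≡ s⟶ a≡ others)) → case ψ ≟ᴸ l of λ where
            (yes refl) → outer (rs-l (_ , _ , ≡-trans (sym θl≡m) b≡ , a≡ , s⟶)) refl
                               (SN-entries-⟶ st sn)
            (no ψ≢l) → case ψ∈ of λ where
              (here ψ≡l)  → ⊥-elim (ψ≢l ψ≡l)
              (there ψ∈L) → inner (rs-L (ψ , ψ∈L , st)) (≡-trans (others l (ψ≢l ∘ sym)) θl≡m)
                                  (SN-entries-⟶ st sn)

RedScoped : Ty → Tm → Set
RedScoped τ r = Red τ r × WellScoped r

RedEntries : Ty → LMap → Set
RedEntries σ = AllEntries (λ ψ → RedScoped (𝒯 σ ψ))

evalT-Red : ∀ σ {θ} → RedEntries σ θ → ∀ q {r} → evalT q θ ≡ just r → RedScoped σ r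
evalT-Red σ = evalT-invariant (λ ψ → RedScoped (𝒯 σ ψ)) (RedScoped σ) atomic binary unary
  where
    atomic : ∀ {ψ r} → Atomic ψ → RedScoped (𝒯 σ ψ) r → RedScoped σ r
    atomic aRefl    x = x
    atomic aBeta    x = x
    atomic aBetaBox x = x
    atomic aTi      x = x
    atomic aTrplNil x = x
    atomic aD       x = x
    apply₂ : ∀ {f x y} → RedScoped (σ ⊃ σ ⊃ σ) f → RedScoped σ x → RedScoped σ y
           → RedScoped σ (app (app f x) y)
    apply₂ (rf , wf) (rx , wx) (ry , wy) = rf _ wx rx _ wy ry , WellScoped-app (WellScoped-app wf wx) wy
    binary : ∀ {ψ f x y} → Binary ψ → RedScoped (𝒯 σ ψ) f → RedScoped σ x → RedScoped σ y
           → RedScoped σ (app (app f x) y)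
    binary bTrans    = apply₂
    binary bApp      = apply₂
    binary bLet      = apply₂
    binary bTrplCons = apply₂
    unary : ∀ {f x} → RedScoped (σ ⊃ σ) f → RedScoped σ x → RedScoped σ (app f x)
    unary (rf , wf) (rx , wx) = rf _ wx rx , WellScoped-app wf wx

Red-TI : ∀ σ {θ} → RedEntries σ θ → Red σ (TI θ)
Red-TI σ red = go (SN-entries⇒Acc allLabels (λ ψ r eq → Red⇒SN (𝒯 σ ψ) (proj₁ (red ψ r eq)))) red
  where
    go : ∀ {θ} → Acc (flip (StepIn allLabels)) θ → RedEntries σ θ → Red σ (TI θ)
    go {θ} (acc rs) red = Red-neutral σ TI next
      where
        next : ∀ {u} → TI θ ⟶ u → Red σ u
        next (TIstep q eq) = proj₁ (evalT-Red σ red q eq)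
        next (ξTI ψ b≡ s⟶ a≡ others) =
          go (rs (ψ , ∈-allLabels ψ , st))
             (StepAt-preserves st (λ (r , w) → Red-⟶ (𝒯 σ ψ) s⟶ r , WellScoped-⟶ w s⟶) red)
          where st = stepAt b≡ s⟶ a≡ others

-- The fundamental lemma

∋⇒< : ∀ {Γ n τ} → Γ ∋ n ∶ τ → n < length Γ
∋⇒< here      = s≤s z≤n
∋⇒< (there x) = s≤s (∋⇒< x)

⊢⇒Scoped : ∀ {Δ Γ s τ} → Δ ︔ Γ ⊢ s ∶ τ → Scoped (length Γ) s
⊢⇒Scoped (⊢var x)   = var (∋⇒< x)
⊢⇒Scoped (⊢avar x)  = avar
⊢⇒Scoped (⊢lam d)   = lam (⊢⇒Scoped d)
⊢⇒Scoped (⊢app d e) = app (⊢⇒Scoped d) (⊢⇒Scoped e)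
⊢⇒Scoped (⊢box d)   = box (⊢⇒Scoped d)
⊢⇒Scoped (⊢let d e) = lett (⊢⇒Scoped d) (⊢⇒Scoped e)
⊢⇒Scoped (⊢TI _ h)  = TI (λ ψ r eq → Scoped-weaken z≤n (⊢⇒Scoped (h ψ r eq)))

WellScopedSubst-bound : ∀ {σ} → WellScopedSubst σ → ∀ m → ∃[ K ] ScopedSubst m K σ
WellScopedSubst-bound ws zero = 0 , λ _ ()
WellScopedSubst-bound {σ} ws (suc m) with WellScopedSubst-bound ws m
... | K , below = K ⊔ proj₁ (ws m) , bound
  where bound : ScopedSubst (suc m) (K ⊔ proj₁ (ws m)) σ
        bound n n<1+m with m<1+n⇒m<n∨m≡n n<1+m
        ... | inj₁ n<m  = Scoped-weaken (m≤m⊔n K _) (below n n<m)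
        ... | inj₂ refl = Scoped-weaken (m≤n⊔m K _) (proj₂ (ws n))

WellScoped-subst : ∀ {Δ Γ s τ σS σA} → Δ ︔ Γ ⊢ s ∶ τ → WellScopedSubst σS → ClosedSubst σA
                 → WellScoped (substS σS (substA σA s))
WellScoped-subst {Γ = Γ} d ws c =
  let K , below = WellScopedSubst-bound ws (length Γ)
  in  K , Scoped-substS below (Scoped-substA c (⊢⇒Scoped d))

RedSubst : Ctx → (ℕ → Tm) → Set
RedSubst Γ σ = ∀ {n τ} → Γ ∋ n ∶ τ → Red τ (σ n)

RedSubst-∷ : ∀ {Γ σ τ t} → Red τ t → RedSubst Γ σ → RedSubst (τ ∷ Γ) (t ∷ˢ σ)
RedSubst-∷ rt rσ here      = rt
RedSubst-∷ rt rσ (there x) = rσ x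

⟶*-unbox : ∀ {s r} → (! s) ⟶* (! r) → s ⟶* r
⟶*-unbox ε                = ε
⟶*-unbox (ξbox st ◅ sts) = st ◅ ⟶*-unbox sts

fundamental : ∀ {Δ Γ s τ σS σA} → Δ ︔ Γ ⊢ s ∶ τ
            → RedSubst Γ σS → WellScopedSubst σS → RedSubst Δ σA → ClosedSubst σA
            → Red τ (substS σS (substA σA s))
fundamental (⊢var x) rS ws rA c = rS x
fundamental (⊢avar {n = n} {τ} x) rS ws rA c = Red-resp-≈ τ (≈-sym (substS-closed (c n))) (rA x)
fundamental {Γ = Γ} (⊢lam {s = s} {τ} {σ} d) rS ws rA c =
  Red-lam τ σ (Scoped-substS (Scoped-extsS (proj₂ (WellScopedSubst-bound ws (length Γ))))
                             (Scoped-substA (ClosedSubst-renS c) (⊢⇒Scoped d)))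
    λ t wt rt → Red-resp-≈ σ (≈-sym ([/a]-substS-substA s ws c))
                  (fundamental d (RedSubst-∷ rt rS) (WellScopedSubst-∷ˢ wt ws) rA c)
fundamental (⊢app d e) rS ws rA c =
  fundamental d rS ws rA c _ (WellScoped-subst e ws c) (fundamental e rS ws rA c)
fundamental {σA = σA} (⊢box {s = s} {τ} d) rS ws rA c =
  SN-box (Red⇒SN τ red-s) , λ r sts → Red-⟶* τ (⟶*-unbox sts) red-s
  where red-s : Red τ (substA σA s)
        red-s = Red-resp-≈ τ (substS-var (λ _ → var) _) (fundamental d (λ ()) WellScopedSubst-var rA c)
fundamental (⊢let {t = t} {τ} {σ} d e) rS ws rA c =
  Red-let τ σ (fundamental d rS ws rA c) (WellScoped-subst d ws c)
    λ r dr rr → Red-resp-≈ σ (≈-sym ([/u]-substS-substA t dr))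
                  (fundamental e rS ws (RedSubst-∷ rr rA) (ClosedSubst-∷ˢ dr c))
fundamental {σS = σS} {σA} (⊢TI {θ = θ} {σ} _ h) rS ws rA c = Red-TI σ red
  where red : RedEntries σ (λ ψ → substSM σS (substAM σA (θ ψ)))
        red ψ r eq with θ ψ in θψ≡
        red ψ _ refl | just r₀ =
          fundamental (h ψ r₀ θψ≡) (λ ()) ws rA c , WellScoped-subst (h ψ r₀ θψ≡) ws c

mainTheorem8 : ∀ {Δ Γ s τ} → Δ ︔ Γ ⊢ s ∶ τ → SN s
mainTheorem8 {s = s} {τ = τ} d =
  Red⇒SN τ (Red-resp-≈ τ (substS-var (λ _ → var) _ ⟨≈⟩ substA-avar (λ _ → avar) s)
    (fundamental d (λ _ → Red-var _) WellScopedSubst-var (λ _ → Red-avar _) ClosedSubst-avar))
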